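{- The group $\mathrm{PSL}_{q}(2,\mathbb{Z})$ is isomorphic to $\mathrm{PSL}(2,\mathbb{Z})$.
   Context: Let $\mathrm{U}=\{\pm q^N: N\in\mathbb{Z}\}$ be the group of units of $\mathbb{Z}[q^{\pm1}]$, let $\mathrm{GL}(2,\mathbb{Z}[q^{\pm1}])$ be the group of $2\times2$ matrices with entries in $\mathbb{Z}[q^{\pm1}]$ and determinant in $\mathrm{U}$, and $\mathrm{PGL}(2,\mathbb{Z}[q^{\pm1}])=\mathrm{GL}(2,\mathbb{Z}[q^{\pm1}])/\mathrm{U}$ (quotient by the scalar matrices $\pm q^N\mathrm{Id}$). Let $R_q=\begin{pmatrix}q&1\\0&1\end{pmatrix}$, $S_q=\begin{pmatrix}0&-q^{ -1}\\1&0\end{pmatrix}$. Then $\mathrm{PSL}_{q}(2,\mathbb{Z})$ is the subgroup of $\mathrm{PGL}(2,\mathbb{Z}[q^{\pm1}])$ generated by the classes of $R_q$ and $S_q$. -}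

module Defs where

open import Level using (0ℓ)
open import Data.Nat as ℕ using (ℕ; zero; suc)
open import Data.Integer as ℤ using (ℤ; +_; -[1+_])
open import Data.Integer.Solver using (module +-*-Solver)
open import Data.List using (List; []; _∷_; replicate; _++_; map; reverse)
open import Data.Sign using (Sign)
open import Data.Product using (Σ; Σ-syntax; _×_; _,_; proj₁)
open import Data.Sum using (_⊎_)
open import Relation.Binary.PropositionalEquality
open import Algebra.Bundles.Raw using (RawGroup)

-- Ordinary polynomials in q: coefficient lists, constant term first.
Poly : Set
Poly = List ℤ

coeffP : Poly → ℕ → ℤ
coeffP []       _       = + 0
coeffP (a ∷ as) zero    = a
coeffP (a ∷ as) (suc n) = coeffP as n

addP : Poly → Poly → Poly
addP []       qs       = qs
addP ps       []       = ps
addP (a ∷ ps) (b ∷ qs) = (a ℤ.+ b) ∷ addP ps qs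

mulP : Poly → Poly → Poly
mulP []       qs = []
mulP (a ∷ ps) qs = addP (map (a ℤ.*_) qs) (+ 0 ∷ mulP ps qs)

shiftP : ℕ → Poly → Poly
shiftP n p = replicate n (+ 0) ++ p

-- A Laurent polynomial (N , p) stands for q^{-N} · p(q).
record Laurent : Set where
  constructor lp
  field
    low  : ℕ
    poly : Poly
open Laurent public

infix 4 _≈L_
_≈L_ : Laurent → Laurent → Set
lp N p ≈L lp M p' = ∀ k → coeffP (shiftP M p) k ≡ coeffP (shiftP N p') k

infixl 6 _+L_
infixl 7 _*L_
_+L_ : Laurent → Laurent → Laurent
lp N p +L lp M p' = lp (N ℕ.+ M) (addP (shiftP M p) (shiftP N p'))

_*L_ : Laurent → Laurent → Laurent
lp N p *L lp M p' = lp (N ℕ.+ M) (mulP p p')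

-L_ : Laurent → Laurent
-L lp N p = lp N (map ℤ.-_ p)

constL : ℤ → Laurent
constL a = lp 0 (a ∷ [])

0L 1L : Laurent
0L = constL (+ 0)
1L = constL (+ 1)

qPow : ℤ → Laurent
qPow (+ n)    = lp 0 (shiftP n (+ 1 ∷ []))
qPow -[1+ n ] = lp (suc n) (+ 1 ∷ [])

unit : Sign → ℤ → Laurent
unit Sign.+ N = qPow N
unit Sign.- N = -L qPow N

record M2L : Set where
  constructor mat
  field
    m11 m12 m21 m22 : Laurent

_≈M_ : M2L → M2L → Set
mat a b c d ≈M mat a' b' c' d' = (a ≈L a') × (b ≈L b') × (c ≈L c') × (d ≈L d')

_*M_ : M2L → M2L → M2L
mat a b c d *M mat e f g h =
  mat (a *L e +L b *L g) (a *L f +L b *L h) (c *L e +L d *L g) (c *L f +L d *L h)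

scaleM : Laurent → M2L → M2L
scaleM u (mat a b c d) = mat (u *L a) (u *L b) (u *L c) (u *L d)

IdM : M2L
IdM = mat 1L 0L 0L 1L

q qInv : Laurent
q    = qPow (+ 1)
qInv = qPow -[1+ 0 ]

Rq Sq RqInv SqInv : M2L
Rq    = mat q 1L 0L 1L
Sq    = mat 0L (-L qInv) 1L 0L
RqInv = mat qInv (-L qInv) 0L 1L
SqInv = mat 0L 1L (-L q) 0L

data Gen : Set where
  R R⁻ S S⁻ : Gen

genM : Gen → M2L
genM R  = Rq
genM R⁻ = RqInv
genM S  = Sq
genM S⁻ = SqInv

invGen : Gen → Gen
invGen R  = R⁻
invGen R⁻ = R
invGen S  = S⁻
invGen S⁻ = S

eval : List Gen → M2L
eval []      = IdM
eval (g ∷ w) = genM g *M eval w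

-- equality in PGL = GL / U : matrices agree up to a unit scalar ±q^N
_≈PGL_ : M2L → M2L → Set
A ≈PGL B = Σ[ s ∈ Sign ] Σ[ N ∈ ℤ ] (A ≈M scaleM (unit s N) B)

-- Elements of the generated subgroup are represented by words in the
-- generators; two words are equal iff their products have the same class
-- in PGL(2,ℤ[q^{±1}]).
PSLq : RawGroup 0ℓ 0ℓ
PSLq = record
  { Carrier = List Gen
  ; _≈_     = λ v w → eval v ≈PGL eval w
  ; _∙_     = _++_
  ; ε       = []
  ; _⁻¹     = λ w → reverse (map invGen w)
  }

record M2Z : Set where
  constructor matZ
  field
    e11 e12 e21 e22 : ℤ

detZ : M2Z → ℤ
detZ (matZ a b c d) = a ℤ.* d ℤ.- b ℤ.* c

_*Z_ : M2Z → M2Z → M2Z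
matZ a b c d *Z matZ e f g h =
  matZ (a ℤ.* e ℤ.+ b ℤ.* g) (a ℤ.* f ℤ.+ b ℤ.* h)
       (c ℤ.* e ℤ.+ d ℤ.* g) (c ℤ.* f ℤ.+ d ℤ.* h)

negZ : M2Z → M2Z
negZ (matZ a b c d) = matZ (ℤ.- a) (ℤ.- b) (ℤ.- c) (ℤ.- d)

adjZ : M2Z → M2Z
adjZ (matZ a b c d) = matZ d (ℤ.- b) (ℤ.- c) a

detZ-* : ∀ A B → detZ (A *Z B) ≡ detZ A ℤ.* detZ B
detZ-* (matZ a b c d) (matZ e f g h) =
  solve 8 (λ a b c d e f g h →
    (a :* e :+ b :* g) :* (c :* f :+ d :* h) :- (a :* f :+ b :* h) :* (c :* e :+ d :* g)
    := (a :* d :- b :* c) :* (e :* h :- f :* g)) refl a b c d e f g h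
  where open +-*-Solver

detZ-adj : ∀ A → detZ (adjZ A) ≡ detZ A
detZ-adj (matZ a b c d) =
  solve 4 (λ a b c d → d :* a :- (:- b) :* (:- c) := a :* d :- b :* c) refl a b c d
  where open +-*-Solver

record SL2Z : Set where
  constructor sl
  field
    matrix : M2Z
    det≡1  : detZ matrix ≡ + 1
open SL2Z public

PSL2Z : RawGroup 0ℓ 0ℓ
PSL2Z = record
  { Carrier = SL2Z
  ; _≈_     = λ A B → (matrix A ≡ matrix B) ⊎ (matrix A ≡ negZ (matrix B))
  ; _∙_     = λ A B → sl (matrix A *Z matrix B)
                         (trans (detZ-* (matrix A) (matrix B))
                                (cong₂ ℤ._*_ (det≡1 A) (det≡1 B)))
  ; ε       = sl (matZ (+ 1) (+ 0) (+ 0) (+ 1)) refl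
  ; _⁻¹     = λ A → sl (adjZ (matrix A)) (trans (detZ-adj (matrix A)) (det≡1 A))
  }

-- Specialising q ↦ 1 is a ring homomorphism ℤ[q^{±1}] → ℤ sending the units ±q^N to ±1; it maps
-- R_q, S_q to R = [[1,1],[0,1]], S = [[0,-1],[1,0]] and so induces a homomorphism PSL_q(2,ℤ) → PSL(2,ℤ),
-- which is onto by Euclid's algorithm on the first column. For injectivity: S_q² and (R_q S_q)³ are
-- scalars, so every word in R_q^{±1}, S_q^{±1} is projectively equal to a normal form S^a W T^b with
-- T = R_q S_q and W a word in R_q and R_q S_q R_q. Over ℤ, W becomes a product of [[1,1],[0,1]] and
-- [[1,0],[1,1]]: a matrix with positive diagonal and non-negative off-diagonal entries, not both zero
-- unless W is empty. So only the empty normal form maps to ±I, and since normal forms are computed by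
-- an action in which inverse letters act inversely, this trivial kernel gives injectivity.

module Submission where

open import Defs
open import Level using (0ℓ)
open import Data.Bool using (Bool; true; false; not)
open import Data.Empty using (⊥-elim)
open import Data.Fin using (#_)
open import Data.Integer as ℤ using (ℤ; +_; -[1+_]; +0; +[1+_])
import Data.Integer.DivMod as DM
import Data.Integer.Properties as ℤP
import Data.Integer.Tactic.RingSolver as ℤSolver
open import Data.List using (List; []; _∷_; _++_; map; replicate; reverse; foldr)
import Data.List.Properties as ListP
open import Data.Maybe using (Maybe; just; nothing)
open import Data.Nat as ℕ using (ℕ; zero; suc)
import Data.Nat.Properties as ℕP
import Data.Nat.Tactic.RingSolver as ℕSolver
open import Data.Product using (∃; Σ-syntax; _×_; _,_; proj₁; proj₂)
open import Data.Sign as Sign using (Sign)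
import Data.Sign.Properties as SignP
open import Data.Sum using (_⊎_; inj₁; inj₂)
open import Data.Vec using (Vec; []; _∷_)
open import Relation.Binary.Bundles using (Setoid)
open import Relation.Binary.PropositionalEquality
import Relation.Binary.Reasoning.Setoid as SetoidReasoning
open import Relation.Nullary using (¬_; yes; no)
open import Algebra.Bundles using (CommutativeMonoid; CommutativeRing)
import Algebra.Consequences.Setoid as Consequences
import Algebra.Properties.CommutativeSemigroup as CommutativeSemigroupProperties
import Algebra.Solver.Ring
open import Algebra.Solver.Ring.AlmostCommutativeRing
  using (AlmostCommutativeRing; fromCommutativeRing; _-Raw-AlmostCommutative⟶_)
open import Algebra.Morphism.Structures using (module GroupMorphisms)

-- Polynomials up to trailing zeros

-- _≋_, and _≃_ below, are the equalities of Defs wrapped in records, so that Agda can infer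
-- their arguments.
infix 4 _≋_
record _≋_ (p r : Poly) : Set where
  constructor coeffwise
  field coeff-≡ : ∀ k → coeffP p k ≡ coeffP r k
open _≋_

≋-setoid : Setoid 0ℓ 0ℓ
≋-setoid = record
  { Carrier       = Poly
  ; _≈_           = _≋_
  ; isEquivalence = record
    { refl  = coeffwise λ _ → refl
    ; sym   = λ p≋r → coeffwise λ k → sym (coeff-≡ p≋r k)
    ; trans = λ p≋r r≋s → coeffwise λ k → trans (coeff-≡ p≋r k) (coeff-≡ r≋s k)
    }
  }

open Setoid ≋-setoid public using () renaming (refl to ≋-refl; sym to ≋-sym; trans to ≋-trans)

≡⇒≋ : ∀ {p r} → p ≡ r → p ≋ r
≡⇒≋ refl = ≋-refl

coeff-addP : ∀ p r k → coeffP (addP p r) k ≡ coeffP p k ℤ.+ coeffP r k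
coeff-addP []      r       k       = sym (ℤP.+-identityˡ _)
coeff-addP (a ∷ p) []      k       = sym (ℤP.+-identityʳ _)
coeff-addP (a ∷ p) (b ∷ r) zero    = refl
coeff-addP (a ∷ p) (b ∷ r) (suc k) = coeff-addP p r k

coeff-map : ∀ (f : ℤ → ℤ) → f +0 ≡ +0 → ∀ p k → coeffP (map f p) k ≡ f (coeffP p k)
coeff-map f f0≡0 []      k       = sym f0≡0
coeff-map f f0≡0 (a ∷ p) zero    = refl
coeff-map f f0≡0 (a ∷ p) (suc k) = coeff-map f f0≡0 p k

coeff-scale : ∀ a p k → coeffP (map (a ℤ.*_) p) k ≡ a ℤ.* coeffP p k
coeff-scale a = coeff-map (a ℤ.*_) (ℤP.*-zeroʳ a)

coeff-neg : ∀ p k → coeffP (map ℤ.-_ p) k ≡ ℤ.- coeffP p k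
coeff-neg = coeff-map ℤ.-_ refl

∷-cong : ∀ {a b p r} → a ≡ b → p ≋ r → a ∷ p ≋ b ∷ r
∷-cong a≡b p≋r = coeffwise λ { zero → a≡b ; (suc k) → coeff-≡ p≋r k }

∷-injective : ∀ {a b p r} → a ∷ p ≋ b ∷ r → p ≋ r
∷-injective a∷p≋b∷r = coeffwise λ k → coeff-≡ a∷p≋b∷r (suc k)

addP-cong : ∀ {p p′ r r′} → p ≋ p′ → r ≋ r′ → addP p r ≋ addP p′ r′
addP-cong {p} {p′} {r} {r′} p≋p′ r≋r′ = coeffwise λ k → begin
  coeffP (addP p r) k            ≡⟨ coeff-addP p r k ⟩
  coeffP p k ℤ.+ coeffP r k      ≡⟨ cong₂ ℤ._+_ (coeff-≡ p≋p′ k) (coeff-≡ r≋r′ k) ⟩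
  coeffP p′ k ℤ.+ coeffP r′ k    ≡⟨ coeff-addP p′ r′ k ⟨
  coeffP (addP p′ r′) k          ∎
  where open ≡-Reasoning

map-cong : ∀ (f : ℤ → ℤ) → f +0 ≡ +0 → ∀ {p r} → p ≋ r → map f p ≋ map f r
map-cong f f0≡0 {p} {r} p≋r = coeffwise λ k → begin
  coeffP (map f p) k  ≡⟨ coeff-map f f0≡0 p k ⟩
  f (coeffP p k)      ≡⟨ cong f (coeff-≡ p≋r k) ⟩
  f (coeffP r k)      ≡⟨ coeff-map f f0≡0 r k ⟨
  coeffP (map f r) k  ∎
  where open ≡-Reasoning

addP-congˡ : ∀ p {r r′} → r ≋ r′ → addP p r ≋ addP p r′
addP-congˡ p = addP-cong (≋-refl {p})

addP-congʳ : ∀ r {p p′} → p ≋ p′ → addP p r ≋ addP p′ r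
addP-congʳ r p≋p′ = addP-cong p≋p′ (≋-refl {r})

addP-comm : ∀ p r → addP p r ≋ addP r p
addP-comm p r = coeffwise λ k → begin
  coeffP (addP p r) k        ≡⟨ coeff-addP p r k ⟩
  coeffP p k ℤ.+ coeffP r k  ≡⟨ ℤP.+-comm (coeffP p k) (coeffP r k) ⟩
  coeffP r k ℤ.+ coeffP p k  ≡⟨ coeff-addP r p k ⟨
  coeffP (addP r p) k        ∎
  where open ≡-Reasoning

addP-assoc : ∀ p r s → addP (addP p r) s ≋ addP p (addP r s)
addP-assoc p r s = coeffwise λ k → begin
  coeffP (addP (addP p r) s) k                       ≡⟨ coeff-addP (addP p r) s k ⟩
  coeffP (addP p r) k ℤ.+ coeffP s k                 ≡⟨ cong (ℤ._+ coeffP s k) (coeff-addP p r k) ⟩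
  coeffP p k ℤ.+ coeffP r k ℤ.+ coeffP s k           ≡⟨ ℤP.+-assoc (coeffP p k) (coeffP r k) (coeffP s k) ⟩
  coeffP p k ℤ.+ (coeffP r k ℤ.+ coeffP s k)         ≡⟨ cong (λ z → coeffP p k ℤ.+ z) (coeff-addP r s k) ⟨
  coeffP p k ℤ.+ coeffP (addP r s) k                 ≡⟨ coeff-addP p (addP r s) k ⟨
  coeffP (addP p (addP r s)) k                       ∎
  where open ≡-Reasoning

addP-identityʳ : ∀ p → addP p [] ≋ p
addP-identityʳ []      = ≋-refl
addP-identityʳ (a ∷ p) = ≋-refl

addP-inverseˡ : ∀ p → addP (map ℤ.-_ p) p ≋ []
addP-inverseˡ p = coeffwise λ k → begin
  coeffP (addP (map ℤ.-_ p) p) k           ≡⟨ coeff-addP (map ℤ.-_ p) p k ⟩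
  coeffP (map ℤ.-_ p) k ℤ.+ coeffP p k     ≡⟨ cong (ℤ._+ coeffP p k) (coeff-neg p k) ⟩
  ℤ.- coeffP p k ℤ.+ coeffP p k            ≡⟨ ℤP.+-inverseˡ (coeffP p k) ⟩
  +0                                       ∎
  where open ≡-Reasoning

addP-commutativeMonoid : CommutativeMonoid 0ℓ 0ℓ
addP-commutativeMonoid = record
  { Carrier = Poly
  ; _≈_ = _≋_
  ; _∙_ = addP
  ; ε = []
  ; isCommutativeMonoid = record
    { isMonoid = record
      { isSemigroup = record
        { isMagma = record { isEquivalence = Setoid.isEquivalence ≋-setoid ; ∙-cong = addP-cong }
        ; assoc = addP-assoc
        }
      ; identity = (λ _ → ≋-refl) , addP-identityʳ
      }
    ; comm = addP-comm
    }
  }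

open CommutativeSemigroupProperties (CommutativeMonoid.commutativeSemigroup addP-commutativeMonoid)
  using () renaming (x∙yz≈y∙xz to addP-leftComm; interchange to addP-interchange)

scale-addP : ∀ a p r → map (a ℤ.*_) (addP p r) ≋ addP (map (a ℤ.*_) p) (map (a ℤ.*_) r)
scale-addP a p r = coeffwise λ k → begin
  coeffP (map (a ℤ.*_) (addP p r)) k                        ≡⟨ coeff-scale a (addP p r) k ⟩
  a ℤ.* coeffP (addP p r) k                                 ≡⟨ cong (a ℤ.*_) (coeff-addP p r k) ⟩
  a ℤ.* (coeffP p k ℤ.+ coeffP r k)                         ≡⟨ ℤP.*-distribˡ-+ a (coeffP p k) (coeffP r k) ⟩
  a ℤ.* coeffP p k ℤ.+ a ℤ.* coeffP r k                     ≡⟨ cong₂ ℤ._+_ (coeff-scale a p k) (coeff-scale a r k) ⟨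
  coeffP (map (a ℤ.*_) p) k ℤ.+ coeffP (map (a ℤ.*_) r) k   ≡⟨ coeff-addP (map (a ℤ.*_) p) (map (a ℤ.*_) r) k ⟨
  coeffP (addP (map (a ℤ.*_) p) (map (a ℤ.*_) r)) k         ∎
  where open ≡-Reasoning

+-scale-addP : ∀ a b p → map ((a ℤ.+ b) ℤ.*_) p ≋ addP (map (a ℤ.*_) p) (map (b ℤ.*_) p)
+-scale-addP a b p = coeffwise λ k → begin
  coeffP (map ((a ℤ.+ b) ℤ.*_) p) k                         ≡⟨ coeff-scale (a ℤ.+ b) p k ⟩
  (a ℤ.+ b) ℤ.* coeffP p k                                  ≡⟨ ℤP.*-distribʳ-+ (coeffP p k) a b ⟩
  a ℤ.* coeffP p k ℤ.+ b ℤ.* coeffP p k                     ≡⟨ cong₂ ℤ._+_ (coeff-scale a p k) (coeff-scale b p k) ⟨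
  coeffP (map (a ℤ.*_) p) k ℤ.+ coeffP (map (b ℤ.*_) p) k   ≡⟨ coeff-addP (map (a ℤ.*_) p) (map (b ℤ.*_) p) k ⟨
  coeffP (addP (map (a ℤ.*_) p) (map (b ℤ.*_) p)) k         ∎
  where open ≡-Reasoning

scale-scale : ∀ a b p → map ((a ℤ.* b) ℤ.*_) p ≋ map (a ℤ.*_) (map (b ℤ.*_) p)
scale-scale a b p = coeffwise λ k → begin
  coeffP (map ((a ℤ.* b) ℤ.*_) p) k         ≡⟨ coeff-scale (a ℤ.* b) p k ⟩
  a ℤ.* b ℤ.* coeffP p k                    ≡⟨ ℤP.*-assoc a b (coeffP p k) ⟩
  a ℤ.* (b ℤ.* coeffP p k)                  ≡⟨ cong (a ℤ.*_) (coeff-scale b p k) ⟨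
  a ℤ.* coeffP (map (b ℤ.*_) p) k           ≡⟨ coeff-scale a (map (b ℤ.*_) p) k ⟨
  coeffP (map (a ℤ.*_) (map (b ℤ.*_) p)) k  ∎
  where open ≡-Reasoning

scale-zero : ∀ {a} → a ≡ +0 → ∀ p → map (a ℤ.*_) p ≋ []
scale-zero {a} refl p = coeffwise λ k → coeff-scale +0 p k

0∷-zero : ∀ {p} → p ≋ [] → +0 ∷ p ≋ []
0∷-zero p≋[] = coeffwise λ { zero → refl ; (suc k) → coeff-≡ p≋[] k }

mulP-zeroˡ : ∀ {p} r → p ≋ [] → mulP p r ≋ []
mulP-zeroˡ {[]}    r _      = ≋-refl
mulP-zeroˡ {a ∷ p} r a∷p≋[] =
  addP-cong (scale-zero (coeff-≡ a∷p≋[] 0) r) (0∷-zero (mulP-zeroˡ r p≋[]))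
  where
  p≋[] : p ≋ []
  p≋[] = coeffwise λ k → coeff-≡ a∷p≋[] (suc k)

mulP-congʳ : ∀ p {r r′} → r ≋ r′ → mulP p r ≋ mulP p r′
mulP-congʳ []      r≋r′ = ≋-refl
mulP-congʳ (a ∷ p) r≋r′ =
  addP-cong (map-cong (a ℤ.*_) (ℤP.*-zeroʳ a) r≋r′) (∷-cong refl (mulP-congʳ p r≋r′))

mulP-congˡ : ∀ {p p′} r → p ≋ p′ → mulP p r ≋ mulP p′ r
mulP-congˡ {[]}    {p′}     r p≋p′ = ≋-sym (mulP-zeroˡ r (≋-sym p≋p′))
mulP-congˡ {a ∷ p} {[]}     r p≋p′ = mulP-zeroˡ r p≋p′
mulP-congˡ {a ∷ p} {b ∷ p′} r p≋p′ =
  addP-cong (≡⇒≋ (cong (λ c → map (c ℤ.*_) r) (coeff-≡ p≋p′ 0)))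
            (∷-cong refl (mulP-congˡ r (∷-injective p≋p′)))

mulP-cong : ∀ {p p′ r r′} → p ≋ p′ → r ≋ r′ → mulP p r ≋ mulP p′ r′
mulP-cong {p′ = p′} {r = r} p≋p′ r≋r′ = ≋-trans (mulP-congˡ r p≋p′) (mulP-congʳ p′ r≋r′)

mulP-[]ʳ : ∀ p → mulP p [] ≋ []
mulP-[]ʳ []      = ≋-refl
mulP-[]ʳ (a ∷ p) = 0∷-zero (mulP-[]ʳ p)

mulP-consʳ : ∀ p b r → mulP p (b ∷ r) ≋ addP (map (b ℤ.*_) p) (+0 ∷ mulP p r)
mulP-consʳ []      b r = ≋-sym (0∷-zero ≋-refl)
mulP-consʳ (a ∷ p) b r = ∷-cong (cong (ℤ._+ +0) (ℤP.*-comm a b)) (begin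
  addP (map (a ℤ.*_) r) (mulP p (b ∷ r))
    ≈⟨ addP-congˡ (map (a ℤ.*_) r) (mulP-consʳ p b r) ⟩
  addP (map (a ℤ.*_) r) (addP (map (b ℤ.*_) p) (+0 ∷ mulP p r))
    ≈⟨ addP-leftComm (map (a ℤ.*_) r) (map (b ℤ.*_) p) (+0 ∷ mulP p r) ⟩
  addP (map (b ℤ.*_) p) (addP (map (a ℤ.*_) r) (+0 ∷ mulP p r))  ∎)
  where open SetoidReasoning ≋-setoid

mulP-comm : ∀ p r → mulP p r ≋ mulP r p
mulP-comm []      r       = ≋-sym (mulP-[]ʳ r)
mulP-comm (a ∷ p) []      = mulP-[]ʳ (a ∷ p)
mulP-comm (a ∷ p) (b ∷ r) = ∷-cong (cong (ℤ._+ +0) (ℤP.*-comm a b)) (begin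
  addP (map (a ℤ.*_) r) (mulP p (b ∷ r))
    ≈⟨ addP-congˡ (map (a ℤ.*_) r) (mulP-consʳ p b r) ⟩
  addP (map (a ℤ.*_) r) (addP (map (b ℤ.*_) p) (+0 ∷ mulP p r))
    ≈⟨ addP-leftComm (map (a ℤ.*_) r) (map (b ℤ.*_) p) (+0 ∷ mulP p r) ⟩
  addP (map (b ℤ.*_) p) (addP (map (a ℤ.*_) r) (+0 ∷ mulP p r))
    ≈⟨ addP-congˡ (map (b ℤ.*_) p) (addP-congˡ (map (a ℤ.*_) r) (∷-cong refl (mulP-comm p r))) ⟩
  addP (map (b ℤ.*_) p) (addP (map (a ℤ.*_) r) (+0 ∷ mulP r p))
    ≈⟨ addP-congˡ (map (b ℤ.*_) p) (mulP-consʳ r a p) ⟨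
  addP (map (b ℤ.*_) p) (mulP r (a ∷ p))  ∎)
  where open SetoidReasoning ≋-setoid

mulP-distribʳ : ∀ p p′ r → mulP (addP p p′) r ≋ addP (mulP p r) (mulP p′ r)
mulP-distribʳ []      p′       r = ≋-refl
mulP-distribʳ (a ∷ p) []       r = ≋-sym (addP-identityʳ _)
mulP-distribʳ (a ∷ p) (b ∷ p′) r = begin
  addP (map ((a ℤ.+ b) ℤ.*_) r) (+0 ∷ mulP (addP p p′) r)
    ≈⟨ addP-cong (+-scale-addP a b r) (∷-cong refl (mulP-distribʳ p p′ r)) ⟩
  addP (addP (map (a ℤ.*_) r) (map (b ℤ.*_) r)) (addP (+0 ∷ mulP p r) (+0 ∷ mulP p′ r))
    ≈⟨ addP-interchange (map (a ℤ.*_) r) (map (b ℤ.*_) r) (+0 ∷ mulP p r) (+0 ∷ mulP p′ r) ⟩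
  addP (addP (map (a ℤ.*_) r) (+0 ∷ mulP p r)) (addP (map (b ℤ.*_) r) (+0 ∷ mulP p′ r))  ∎
  where open SetoidReasoning ≋-setoid

mulP-scaleˡ : ∀ a p r → mulP (map (a ℤ.*_) p) r ≋ map (a ℤ.*_) (mulP p r)
mulP-scaleˡ a []      r = ≋-refl
mulP-scaleˡ a (b ∷ p) r = begin
  addP (map ((a ℤ.* b) ℤ.*_) r) (+0 ∷ mulP (map (a ℤ.*_) p) r)
    ≈⟨ addP-cong (scale-scale a b r) (∷-cong (sym (ℤP.*-zeroʳ a)) (mulP-scaleˡ a p r)) ⟩
  addP (map (a ℤ.*_) (map (b ℤ.*_) r)) (map (a ℤ.*_) (+0 ∷ mulP p r))
    ≈⟨ scale-addP a (map (b ℤ.*_) r) (+0 ∷ mulP p r) ⟨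
  map (a ℤ.*_) (addP (map (b ℤ.*_) r) (+0 ∷ mulP p r))  ∎
  where open SetoidReasoning ≋-setoid

mulP-assoc : ∀ p r s → mulP (mulP p r) s ≋ mulP p (mulP r s)
mulP-assoc []      r s = ≋-refl
mulP-assoc (a ∷ p) r s = begin
  mulP (addP (map (a ℤ.*_) r) (+0 ∷ mulP p r)) s
    ≈⟨ mulP-distribʳ (map (a ℤ.*_) r) (+0 ∷ mulP p r) s ⟩
  addP (mulP (map (a ℤ.*_) r) s) (mulP (+0 ∷ mulP p r) s)
    ≈⟨ addP-cong (mulP-scaleˡ a r s) (addP-cong (scale-zero refl s) (∷-cong refl (mulP-assoc p r s))) ⟩
  addP (map (a ℤ.*_) (mulP r s)) (+0 ∷ mulP p (mulP r s))  ∎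
  where open SetoidReasoning ≋-setoid

mulP-identityˡ : ∀ p → mulP (+ 1 ∷ []) p ≋ p
mulP-identityˡ p = coeffwise λ k → begin
  coeffP (addP (map (+ 1 ℤ.*_) p) (+0 ∷ [])) k     ≡⟨ coeff-addP (map (+ 1 ℤ.*_) p) (+0 ∷ []) k ⟩
  coeffP (map (+ 1 ℤ.*_) p) k ℤ.+ coeffP (+0 ∷ []) k
    ≡⟨ cong₂ ℤ._+_ (coeff-scale (+ 1) p k) (coeff-≡ (0∷-zero ≋-refl) k) ⟩
  + 1 ℤ.* coeffP p k ℤ.+ +0                          ≡⟨ ℤP.+-identityʳ _ ⟩
  + 1 ℤ.* coeffP p k                                 ≡⟨ ℤP.*-identityˡ _ ⟩
  coeffP p k                                         ∎
  where open ≡-Reasoning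

shiftP-+ : ∀ m n p → shiftP m (shiftP n p) ≡ shiftP (m ℕ.+ n) p
shiftP-+ zero    n p = refl
shiftP-+ (suc m) n p = cong (+0 ∷_) (shiftP-+ m n p)

shiftP-reassoc : ∀ a b c d p → a ℕ.+ b ≡ c ℕ.+ d → shiftP a (shiftP b p) ≡ shiftP c (shiftP d p)
shiftP-reassoc a b c d p a+b≡c+d =
  trans (shiftP-+ a b p) (trans (cong (λ n → shiftP n p) a+b≡c+d) (sym (shiftP-+ c d p)))

coeff-shiftP : ∀ n p k → coeffP (shiftP n p) (n ℕ.+ k) ≡ coeffP p k
coeff-shiftP zero    p k = refl
coeff-shiftP (suc n) p k = coeff-shiftP n p k

shiftP-cancel : ∀ n {p r} → shiftP n p ≋ shiftP n r → p ≋ r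
shiftP-cancel n {p} {r} np≋nr = coeffwise λ k →
  trans (sym (coeff-shiftP n p k)) (trans (coeff-≡ np≋nr (n ℕ.+ k)) (coeff-shiftP n r k))

shiftP-cong : ∀ n {p r} → p ≋ r → shiftP n p ≋ shiftP n r
shiftP-cong zero    p≋r = p≋r
shiftP-cong (suc n) p≋r = ∷-cong refl (shiftP-cong n p≋r)

shiftP-addP : ∀ n p r → shiftP n (addP p r) ≡ addP (shiftP n p) (shiftP n r)
shiftP-addP zero    p r = refl
shiftP-addP (suc n) p r = cong (+0 ∷_) (shiftP-addP n p r)

shiftP-neg : ∀ n p → shiftP n (map ℤ.-_ p) ≡ map ℤ.-_ (shiftP n p)
shiftP-neg zero    p = refl
shiftP-neg (suc n) p = cong (+0 ∷_) (shiftP-neg n p)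

shiftP-zero : ∀ n → shiftP n (+0 ∷ []) ≋ []
shiftP-zero zero    = 0∷-zero ≋-refl
shiftP-zero (suc n) = 0∷-zero (shiftP-zero n)

mulP-shiftPˡ : ∀ n p r → mulP (shiftP n p) r ≋ shiftP n (mulP p r)
mulP-shiftPˡ zero    p r = ≋-refl
mulP-shiftPˡ (suc n) p r = addP-cong (scale-zero refl r) (∷-cong refl (mulP-shiftPˡ n p r))

mulP-shiftPʳ : ∀ n p r → mulP p (shiftP n r) ≋ shiftP n (mulP p r)
mulP-shiftPʳ n p r = begin
  mulP p (shiftP n r)   ≈⟨ mulP-comm p (shiftP n r) ⟩
  mulP (shiftP n r) p   ≈⟨ mulP-shiftPˡ n r p ⟩
  shiftP n (mulP r p)   ≈⟨ shiftP-cong n (mulP-comm r p) ⟩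
  shiftP n (mulP p r)   ∎
  where open SetoidReasoning ≋-setoid

shiftP-mulP : ∀ m n p r → shiftP (m ℕ.+ n) (mulP p r) ≋ mulP (shiftP m p) (shiftP n r)
shiftP-mulP m n p r = begin
  shiftP (m ℕ.+ n) (mulP p r)           ≡⟨ shiftP-+ m n (mulP p r) ⟨
  shiftP m (shiftP n (mulP p r))        ≈⟨ shiftP-cong m (mulP-shiftPʳ n p r) ⟨
  shiftP m (mulP p (shiftP n r))        ≈⟨ mulP-shiftPˡ m p (shiftP n r) ⟨
  mulP (shiftP m p) (shiftP n r)        ∎
  where open SetoidReasoning ≋-setoid

-- Laurent polynomials form a commutative ring

infix 4 _≃_
record _≃_ (x y : Laurent) : Set where
  constructor crosswise
  field cross : shiftP (low y) (poly x) ≋ shiftP (low x) (poly y)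
open _≃_

≃-setoid : Setoid 0ℓ 0ℓ
≃-setoid = record
  { Carrier       = Laurent
  ; _≈_           = _≃_
  ; isEquivalence = record
    { refl  = crosswise ≋-refl
    ; sym   = λ x≃y → crosswise (≋-sym (cross x≃y))
    ; trans = ≃-trans
    }
  }
  where
  ≃-trans : ∀ {x y z} → x ≃ y → y ≃ z → x ≃ z
  ≃-trans {lp N p} {lp M r} {lp K s} (crosswise Mp≋Nr) (crosswise Kr≋Ms) =
    crosswise (shiftP-cancel M (begin
      shiftP M (shiftP K p)  ≡⟨ shiftP-reassoc M K K M p (ℕP.+-comm M K) ⟩
      shiftP K (shiftP M p)  ≈⟨ shiftP-cong K Mp≋Nr ⟩
      shiftP K (shiftP N r)  ≡⟨ shiftP-reassoc K N N K r (ℕP.+-comm K N) ⟩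
      shiftP N (shiftP K r)  ≈⟨ shiftP-cong N Kr≋Ms ⟩
      shiftP N (shiftP M s)  ≡⟨ shiftP-reassoc N M M N s (ℕP.+-comm N M) ⟩
      shiftP M (shiftP N s)  ∎))
    where open SetoidReasoning ≋-setoid

open Setoid ≃-setoid public using () renaming (refl to ≃-refl; sym to ≃-sym; trans to ≃-trans)

lp-cong : ∀ {N M p r} → N ≡ M → p ≋ r → lp N p ≃ lp M r
lp-cong {N} refl p≋r = crosswise (shiftP-cong N p≋r)

lp-expand : ∀ k N p → lp N p ≃ lp (k ℕ.+ N) (shiftP k p)
lp-expand k N p = crosswise (≡⇒≋ (shiftP-reassoc 0 (k ℕ.+ N) N k p (ℕP.+-comm k N)))

+L-cong : ∀ {x x′ y y′} → x ≃ x′ → y ≃ y′ → x +L y ≃ x′ +L y′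
+L-cong {lp N p} {lp N′ p′} {lp M r} {lp M′ r′} (crosswise N′p≋Np′) (crosswise M′r≋Mr′) = crosswise (begin
  shiftP (N′ ℕ.+ M′) (addP (shiftP M p) (shiftP N r))
    ≡⟨ shiftP-addP (N′ ℕ.+ M′) (shiftP M p) (shiftP N r) ⟩
  addP (shiftP (N′ ℕ.+ M′) (shiftP M p)) (shiftP (N′ ℕ.+ M′) (shiftP N r))
    ≡⟨ cong₂ addP (shiftP-reassoc (N′ ℕ.+ M′) M (M′ ℕ.+ M) N′ p (rot N′ M′ M))
                  (shiftP-reassoc (N′ ℕ.+ M′) N (N′ ℕ.+ N) M′ r (swap N′ M′ N)) ⟩
  addP (shiftP (M′ ℕ.+ M) (shiftP N′ p)) (shiftP (N′ ℕ.+ N) (shiftP M′ r))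
    ≈⟨ addP-cong (shiftP-cong (M′ ℕ.+ M) N′p≋Np′) (shiftP-cong (N′ ℕ.+ N) M′r≋Mr′) ⟩
  addP (shiftP (M′ ℕ.+ M) (shiftP N p′)) (shiftP (N′ ℕ.+ N) (shiftP M r′))
    ≡⟨ cong₂ addP (shiftP-reassoc (M′ ℕ.+ M) N (N ℕ.+ M) M′ p′ (rev M′ M N))
                  (shiftP-reassoc (N′ ℕ.+ N) M (N ℕ.+ M) N′ r′ (rot N′ N M)) ⟩
  addP (shiftP (N ℕ.+ M) (shiftP M′ p′)) (shiftP (N ℕ.+ M) (shiftP N′ r′))
    ≡⟨ shiftP-addP (N ℕ.+ M) (shiftP M′ p′) (shiftP N′ r′) ⟨
  shiftP (N ℕ.+ M) (addP (shiftP M′ p′) (shiftP N′ r′))  ∎)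
  where
  open SetoidReasoning ≋-setoid
  rot : ∀ a b c → a ℕ.+ b ℕ.+ c ≡ b ℕ.+ c ℕ.+ a
  rot = ℕSolver.solve-∀
  swap : ∀ a b c → a ℕ.+ b ℕ.+ c ≡ a ℕ.+ c ℕ.+ b
  swap = ℕSolver.solve-∀
  rev : ∀ a b c → a ℕ.+ b ℕ.+ c ≡ c ℕ.+ b ℕ.+ a
  rev = ℕSolver.solve-∀

-L-cong : ∀ {x x′} → x ≃ x′ → -L x ≃ -L x′
-L-cong {lp N p} {lp N′ p′} (crosswise N′p≋Np′) = crosswise (begin
  shiftP N′ (map ℤ.-_ p)   ≡⟨ shiftP-neg N′ p ⟩
  map ℤ.-_ (shiftP N′ p)   ≈⟨ map-cong ℤ.-_ refl N′p≋Np′ ⟩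
  map ℤ.-_ (shiftP N p′)   ≡⟨ shiftP-neg N p′ ⟨
  shiftP N (map ℤ.-_ p′)   ∎)
  where open SetoidReasoning ≋-setoid

*L-cong : ∀ {x x′ y y′} → x ≃ x′ → y ≃ y′ → x *L y ≃ x′ *L y′
*L-cong {lp N p} {lp N′ p′} {lp M r} {lp M′ r′} (crosswise N′p≋Np′) (crosswise M′r≋Mr′) = crosswise (begin
  shiftP (N′ ℕ.+ M′) (mulP p r)    ≈⟨ shiftP-mulP N′ M′ p r ⟩
  mulP (shiftP N′ p) (shiftP M′ r)  ≈⟨ mulP-cong N′p≋Np′ M′r≋Mr′ ⟩
  mulP (shiftP N p′) (shiftP M r′)  ≈⟨ shiftP-mulP N M p′ r′ ⟨
  shiftP (N ℕ.+ M) (mulP p′ r′)    ∎)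
  where open SetoidReasoning ≋-setoid

+L-comm : ∀ x y → x +L y ≃ y +L x
+L-comm (lp N p) (lp M r) = lp-cong (ℕP.+-comm N M) (addP-comm (shiftP M p) (shiftP N r))

+L-assoc : ∀ x y z → (x +L y) +L z ≃ x +L (y +L z)
+L-assoc (lp N p) (lp M r) (lp K s) = lp-cong (ℕP.+-assoc N M K) (begin
  addP (shiftP K (addP (shiftP M p) (shiftP N r))) (shiftP (N ℕ.+ M) s)
    ≡⟨ cong (λ u → addP u (shiftP (N ℕ.+ M) s))
            (trans (shiftP-addP K (shiftP M p) (shiftP N r)) (cong₂ addP (shiftP-+ K M p) (shiftP-+ K N r))) ⟩
  addP (addP (shiftP (K ℕ.+ M) p) (shiftP (K ℕ.+ N) r)) (shiftP (N ℕ.+ M) s)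
    ≈⟨ addP-assoc (shiftP (K ℕ.+ M) p) (shiftP (K ℕ.+ N) r) (shiftP (N ℕ.+ M) s) ⟩
  addP (shiftP (K ℕ.+ M) p) (addP (shiftP (K ℕ.+ N) r) (shiftP (N ℕ.+ M) s))
    ≡⟨ cong₂ (λ a b → addP (shiftP a p) (addP (shiftP b r) (shiftP (N ℕ.+ M) s))) (ℕP.+-comm K M) (ℕP.+-comm K N) ⟩
  addP (shiftP (M ℕ.+ K) p) (addP (shiftP (N ℕ.+ K) r) (shiftP (N ℕ.+ M) s))
    ≡⟨ cong (addP (shiftP (M ℕ.+ K) p))
            (trans (shiftP-addP N (shiftP K r) (shiftP M s)) (cong₂ addP (shiftP-+ N K r) (shiftP-+ N M s))) ⟨
  addP (shiftP (M ℕ.+ K) p) (shiftP N (addP (shiftP K r) (shiftP M s)))  ∎)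
  where open SetoidReasoning ≋-setoid

+L-identityˡ : ∀ x → 0L +L x ≃ x
+L-identityˡ (lp N p) = lp-cong refl (addP-congʳ p (shiftP-zero N))

+L-inverseˡ : ∀ x → -L x +L x ≃ 0L
+L-inverseˡ (lp N p) = crosswise (begin
  addP (shiftP N (map ℤ.-_ p)) (shiftP N p)  ≡⟨ cong (λ u → addP u (shiftP N p)) (shiftP-neg N p) ⟩
  addP (map ℤ.-_ (shiftP N p)) (shiftP N p)  ≈⟨ addP-inverseˡ (shiftP N p) ⟩
  []                                          ≈⟨ shiftP-zero (N ℕ.+ N) ⟨
  shiftP (N ℕ.+ N) (+0 ∷ [])                 ∎)
  where open SetoidReasoning ≋-setoid

*L-comm : ∀ x y → x *L y ≃ y *L x
*L-comm (lp N p) (lp M r) = lp-cong (ℕP.+-comm N M) (mulP-comm p r)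

*L-assoc : ∀ x y z → (x *L y) *L z ≃ x *L (y *L z)
*L-assoc (lp N p) (lp M r) (lp K s) = lp-cong (ℕP.+-assoc N M K) (mulP-assoc p r s)

*L-identityˡ : ∀ x → 1L *L x ≃ x
*L-identityˡ (lp N p) = lp-cong refl (mulP-identityˡ p)

*L-distribʳ : ∀ x y z → (y +L z) *L x ≃ y *L x +L z *L x
*L-distribʳ (lp K s) (lp N p) (lp M r) = ≃-trans (lp-expand K (N ℕ.+ M ℕ.+ K) (mulP (addP (shiftP M p) (shiftP N r)) s))
  (lp-cong (lows K N M) (begin
    shiftP K (mulP (addP (shiftP M p) (shiftP N r)) s)
      ≈⟨ shiftP-cong K (mulP-distribʳ (shiftP M p) (shiftP N r) s) ⟩
    shiftP K (addP (mulP (shiftP M p) s) (mulP (shiftP N r) s))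
      ≈⟨ shiftP-cong K (addP-cong (mulP-shiftPˡ M p s) (mulP-shiftPˡ N r s)) ⟩
    shiftP K (addP (shiftP M (mulP p s)) (shiftP N (mulP r s)))
      ≡⟨ shiftP-addP K (shiftP M (mulP p s)) (shiftP N (mulP r s)) ⟩
    addP (shiftP K (shiftP M (mulP p s))) (shiftP K (shiftP N (mulP r s)))
      ≡⟨ cong₂ addP (shiftP-reassoc K M 0 (M ℕ.+ K) (mulP p s) (ℕP.+-comm K M))
                    (shiftP-reassoc K N 0 (N ℕ.+ K) (mulP r s) (ℕP.+-comm K N)) ⟩
    addP (shiftP (M ℕ.+ K) (mulP p s)) (shiftP (N ℕ.+ K) (mulP r s))  ∎))
  where
  open SetoidReasoning ≋-setoid
  lows : ∀ k n m → k ℕ.+ (n ℕ.+ m ℕ.+ k) ≡ n ℕ.+ k ℕ.+ (m ℕ.+ k)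
  lows = ℕSolver.solve-∀

Laurent-commutativeRing : CommutativeRing 0ℓ 0ℓ
Laurent-commutativeRing = record
  { Carrier = Laurent
  ; _≈_ = _≃_
  ; _+_ = _+L_
  ; _*_ = _*L_
  ; -_  = -L_
  ; 0#  = 0L
  ; 1#  = 1L
  ; isCommutativeRing = record
    { isRing = record
      { +-isAbelianGroup = record
        { isGroup = record
          { isMonoid = record
            { isSemigroup = record
              { isMagma = record { isEquivalence = Setoid.isEquivalence ≃-setoid ; ∙-cong = +L-cong }
              ; assoc = +L-assoc
              }
            ; identity = comm∧idˡ⇒id +L-comm +L-identityˡ
            }
          ; inverse = comm∧invˡ⇒inv +L-comm +L-inverseˡ
          ; ⁻¹-cong = -L-cong
          }
        ; comm = +L-comm
        }
      ; *-cong     = *L-cong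
      ; *-assoc    = *L-assoc
      ; *-identity = comm∧idˡ⇒id *L-comm *L-identityˡ
      ; distrib    = comm∧distrʳ⇒distr +L-cong *L-comm *L-distribʳ
      }
    ; *-comm = *L-comm
    }
  }
  where open Consequences ≃-setoid

Laurent-almostCommutativeRing : AlmostCommutativeRing 0ℓ 0ℓ
Laurent-almostCommutativeRing = fromCommutativeRing Laurent-commutativeRing

constL-morphism : ℤ.+-*-rawRing -Raw-AlmostCommutative⟶ Laurent-almostCommutativeRing
constL-morphism = record
  { ⟦_⟧    = constL
  ; +-homo = λ _ _ → ≃-refl
  ; *-homo = λ a b → lp-cong refl (≡⇒≋ (cong (_∷ []) (sym (ℤP.+-identityʳ (a ℤ.* b)))))
  ; -‿homo = λ _ → ≃-refl
  ; 0-homo = ≃-refl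
  ; 1-homo = ≃-refl
  }

constL-≟ : ∀ a b → Maybe (constL a ≃ constL b)
constL-≟ a b with a ℤ.≟ b
... | yes refl = just ≃-refl
... | no  _    = nothing

module LaurentSolver = Algebra.Solver.Ring ℤ.+-*-rawRing Laurent-almostCommutativeRing constL-morphism constL-≟

monomial : ℕ → ℕ → Laurent
monomial a b = lp a (shiftP b (+ 1 ∷ []))

monomial-* : ∀ a b c d → monomial a b *L monomial c d ≃ monomial (a ℕ.+ c) (b ℕ.+ d)
monomial-* a b c d = lp-cong refl (begin
  mulP (shiftP b (+ 1 ∷ [])) (shiftP d (+ 1 ∷ []))  ≈⟨ mulP-shiftPˡ b (+ 1 ∷ []) (shiftP d (+ 1 ∷ [])) ⟩
  shiftP b (mulP (+ 1 ∷ []) (shiftP d (+ 1 ∷ [])))  ≈⟨ shiftP-cong b (mulP-identityˡ (shiftP d (+ 1 ∷ []))) ⟩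
  shiftP b (shiftP d (+ 1 ∷ []))                    ≡⟨ shiftP-+ b d (+ 1 ∷ []) ⟩
  shiftP (b ℕ.+ d) (+ 1 ∷ [])                       ∎)
  where open SetoidReasoning ≋-setoid

monomial-cong : ∀ {a b c d} → b ℕ.+ c ≡ d ℕ.+ a → monomial a b ≃ monomial c d
monomial-cong {a} {b} {c} {d} b+c≡d+a =
  crosswise (≡⇒≋ (shiftP-reassoc c b a d (+ 1 ∷ []) (trans (ℕP.+-comm c b) (trans b+c≡d+a (ℕP.+-comm d a)))))

_⁺ _⁻ : ℤ → ℕ
(+ n)    ⁺ = n
-[1+ n ] ⁺ = 0
(+ n)    ⁻ = 0
-[1+ n ] ⁻ = suc n

⁺≡+⁻ : ∀ N → + (N ⁺) ≡ N ℤ.+ + (N ⁻)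
⁺≡+⁻ (+ n)    = sym (ℤP.+-identityʳ (+ n))
⁺≡+⁻ -[1+ n ] = sym (ℤP.+-inverseˡ (+ suc n))

qPow-monomial : ∀ N → qPow N ≡ monomial (N ⁻) (N ⁺)
qPow-monomial (+ n)    = refl
qPow-monomial -[1+ n ] = refl

⁺⁻-+ : ∀ N M → N ⁺ ℕ.+ M ⁺ ℕ.+ (N ℤ.+ M) ⁻ ≡ (N ℤ.+ M) ⁺ ℕ.+ (N ⁻ ℕ.+ M ⁻)
⁺⁻-+ N M = ℤP.+-injective (begin
  + (N ⁺) ℤ.+ + (M ⁺) ℤ.+ + ((N ℤ.+ M) ⁻)
    ≡⟨ cong (λ z → z ℤ.+ + ((N ℤ.+ M) ⁻)) (cong₂ ℤ._+_ (⁺≡+⁻ N) (⁺≡+⁻ M)) ⟩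
  N ℤ.+ + (N ⁻) ℤ.+ (M ℤ.+ + (M ⁻)) ℤ.+ + ((N ℤ.+ M) ⁻)
    ≡⟨ shuffle N M (+ (N ⁻)) (+ (M ⁻)) (+ ((N ℤ.+ M) ⁻)) ⟩
  N ℤ.+ M ℤ.+ + ((N ℤ.+ M) ⁻) ℤ.+ (+ (N ⁻) ℤ.+ + (M ⁻))
    ≡⟨ cong (ℤ._+ (+ (N ⁻) ℤ.+ + (M ⁻))) (⁺≡+⁻ (N ℤ.+ M)) ⟨
  + ((N ℤ.+ M) ⁺) ℤ.+ (+ (N ⁻) ℤ.+ + (M ⁻))  ∎)
  where
  open ≡-Reasoning
  shuffle : ∀ n m a b c → n ℤ.+ a ℤ.+ (m ℤ.+ b) ℤ.+ c ≡ n ℤ.+ m ℤ.+ c ℤ.+ (a ℤ.+ b)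
  shuffle = ℤSolver.solve-∀

qPow-+ : ∀ N M → qPow N *L qPow M ≃ qPow (N ℤ.+ M)
qPow-+ N M = begin
  qPow N *L qPow M                                ≡⟨ cong₂ _*L_ (qPow-monomial N) (qPow-monomial M) ⟩
  monomial (N ⁻) (N ⁺) *L monomial (M ⁻) (M ⁺)    ≈⟨ monomial-* (N ⁻) (N ⁺) (M ⁻) (M ⁺) ⟩
  monomial (N ⁻ ℕ.+ M ⁻) (N ⁺ ℕ.+ M ⁺)            ≈⟨ monomial-cong (⁺⁻-+ N M) ⟩
  monomial ((N ℤ.+ M) ⁻) ((N ℤ.+ M) ⁺)            ≡⟨ qPow-monomial (N ℤ.+ M) ⟨
  qPow (N ℤ.+ M)                                  ∎
  where open SetoidReasoning ≃-setoid

signed : Sign → Laurent → Laurent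
signed Sign.+ x = x
signed Sign.- x = -L x

unit-signed : ∀ s N → unit s N ≡ signed s (qPow N)
unit-signed Sign.+ N = refl
unit-signed Sign.- N = refl

signed-cong : ∀ s {x y} → x ≃ y → signed s x ≃ signed s y
signed-cong Sign.+ x≃y = x≃y
signed-cong Sign.- x≃y = -L-cong x≃y

signed-* : ∀ s t x y → signed s x *L signed t y ≃ signed (s Sign.* t) (x *L y)
signed-* Sign.+ Sign.+ x y = ≃-refl
signed-* Sign.+ Sign.- x y = solve 2 (λ x y → x :* (:- y) := :- (x :* y)) ≃-refl x y
  where open LaurentSolver
signed-* Sign.- Sign.+ x y = solve 2 (λ x y → (:- x) :* y := :- (x :* y)) ≃-refl x y
  where open LaurentSolver
signed-* Sign.- Sign.- x y = solve 2 (λ x y → (:- x) :* (:- y) := x :* y) ≃-refl x y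
  where open LaurentSolver

unit-* : ∀ s N t M → unit s N *L unit t M ≃ unit (s Sign.* t) (N ℤ.+ M)
unit-* s N t M rewrite unit-signed s N | unit-signed t M | unit-signed (s Sign.* t) (N ℤ.+ M) =
  ≃-trans (signed-* s t (qPow N) (qPow M)) (signed-cong (s Sign.* t) (qPow-+ N M))

unit-inverseˡ : ∀ s N → unit s (ℤ.- N) *L unit s N ≃ 1L
unit-inverseˡ s N = subst₂ (λ t M → unit s (ℤ.- N) *L unit s N ≃ unit t M)
  (SignP.s*s≡+ s) (ℤP.+-inverseˡ N) (unit-* s (ℤ.- N) s N)

q*qInv≃1 : q *L qInv ≃ 1L
q*qInv≃1 = crosswise (coeffwise λ { zero → refl ; (suc zero) → refl ; (suc (suc k)) → refl })

infix 4 _≃M_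
record _≃M_ (A B : M2L) : Set where
  constructor entrywise
  field
    ≃₁₁ : M2L.m11 A ≃ M2L.m11 B
    ≃₁₂ : M2L.m12 A ≃ M2L.m12 B
    ≃₂₁ : M2L.m21 A ≃ M2L.m21 B
    ≃₂₂ : M2L.m22 A ≃ M2L.m22 B

≃M-setoid : Setoid 0ℓ 0ℓ
≃M-setoid = record
  { Carrier       = M2L
  ; _≈_           = _≃M_
  ; isEquivalence = record
    { refl  = entrywise ≃-refl ≃-refl ≃-refl ≃-refl
    ; sym   = λ (entrywise a b c d) → entrywise (≃-sym a) (≃-sym b) (≃-sym c) (≃-sym d)
    ; trans = λ (entrywise a b c d) (entrywise a′ b′ c′ d′) →
                entrywise (≃-trans a a′) (≃-trans b b′) (≃-trans c c′) (≃-trans d d′)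
    }
  }

open Setoid ≃M-setoid public using () renaming (refl to ≃M-refl; sym to ≃M-sym; trans to ≃M-trans)

*M-cong : ∀ {A A′ B B′} → A ≃M A′ → B ≃M B′ → A *M B ≃M A′ *M B′
*M-cong (entrywise a b c d) (entrywise e f g h) =
  entrywise (+L-cong (*L-cong a e) (*L-cong b g)) (+L-cong (*L-cong a f) (*L-cong b h))
            (+L-cong (*L-cong c e) (*L-cong d g)) (+L-cong (*L-cong c f) (*L-cong d h))

scaleM-cong : ∀ {u u′ A A′} → u ≃ u′ → A ≃M A′ → scaleM u A ≃M scaleM u′ A′
scaleM-cong u≃u′ (entrywise a b c d) = entrywise (*L-cong u≃u′ a) (*L-cong u≃u′ b) (*L-cong u≃u′ c) (*L-cong u≃u′ d)

scaleM-congˡ : ∀ A {u u′} → u ≃ u′ → scaleM u A ≃M scaleM u′ A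
scaleM-congˡ A u≃u′ = scaleM-cong u≃u′ (≃M-refl {A})

scaleM-congʳ : ∀ u {A A′} → A ≃M A′ → scaleM u A ≃M scaleM u A′
scaleM-congʳ u = scaleM-cong (≃-refl {u})

-- Matrices of solver polynomials: a matrix identity is proved as four ring identities.
record PolyMat (n : ℕ) : Set where
  constructor pmat
  field p₁₁ p₁₂ p₂₁ p₂₂ : LaurentSolver.Polynomial n

module _ {n : ℕ} where
  open LaurentSolver using (Polynomial; _:+_; _:*_; ⟦_⟧; ⟦_⟧↓; prove)

  infixl 7 _⊗_
  _⊗_ : PolyMat n → PolyMat n → PolyMat n
  pmat a b c d ⊗ pmat e f g h = pmat (a :* e :+ b :* g) (a :* f :+ b :* h) (c :* e :+ d :* g) (c :* f :+ d :* h)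

  _⊙_ : Polynomial n → PolyMat n → PolyMat n
  u ⊙ pmat a b c d = pmat (u :* a) (u :* b) (u :* c) (u :* d)

  ⟦_⟧M ⟦_⟧↓M : PolyMat n → Vec Laurent n → M2L
  ⟦ pmat a b c d ⟧M  ρ = mat (⟦ a ⟧ ρ) (⟦ b ⟧ ρ) (⟦ c ⟧ ρ) (⟦ d ⟧ ρ)
  ⟦ pmat a b c d ⟧↓M ρ = mat (⟦ a ⟧↓ ρ) (⟦ b ⟧↓ ρ) (⟦ c ⟧↓ ρ) (⟦ d ⟧↓ ρ)

  proveM : ∀ ρ (A B : PolyMat n) → ⟦ A ⟧↓M ρ ≃M ⟦ B ⟧↓M ρ → ⟦ A ⟧M ρ ≃M ⟦ B ⟧M ρ
  proveM ρ (pmat a b c d) (pmat a′ b′ c′ d′) (entrywise e₁₁ e₁₂ e₂₁ e₂₂) =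
    entrywise (prove ρ a a′ e₁₁) (prove ρ b b′ e₁₂) (prove ρ c c′ e₂₁) (prove ρ d d′ e₂₂)

module _ where
  open LaurentSolver using (Polynomial; var)

  private
    G A : PolyMat 9
    G = pmat (var (# 0)) (var (# 1)) (var (# 2)) (var (# 3))
    A = pmat (var (# 4)) (var (# 5)) (var (# 6)) (var (# 7))
    u : Polynomial 9
    u = var (# 8)

    env : M2L → M2L → Laurent → Vec Laurent 9
    env (mat g₁₁ g₁₂ g₂₁ g₂₂) (mat a₁₁ a₁₂ a₂₁ a₂₂) x =
      g₁₁ ∷ g₁₂ ∷ g₂₁ ∷ g₂₂ ∷ a₁₁ ∷ a₁₂ ∷ a₂₁ ∷ a₂₂ ∷ x ∷ []

  *M-scaleM : ∀ B v C → B *M scaleM v C ≃M scaleM v (B *M C)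
  *M-scaleM B v C = proveM (env B C v) (G ⊗ (u ⊙ A)) (u ⊙ (G ⊗ A)) ≃M-refl

  scaleM-scaleM : ∀ v w C → scaleM v (scaleM w C) ≃M scaleM (v *L w) C
  scaleM-scaleM v w C = proveM (env (mat w w w w) C v) (u ⊙ (var (# 0) ⊙ A)) ((u LaurentSolver.:* var (# 0)) ⊙ A) ≃M-refl

  scaleM-identity : ∀ C → scaleM 1L C ≃M C
  scaleM-identity C = proveM (env C C 1L) (u ⊙ A) A ≃M-refl

infix 4 _∼_
_∼_ : M2L → M2L → Set
A ∼ B = Σ[ s ∈ Sign ] Σ[ N ∈ ℤ ] A ≃M scaleM (unit s N) B

≃M⇒∼ : ∀ {A B} → A ≃M B → A ∼ B
≃M⇒∼ {B = B} A≃B = Sign.+ , +0 , ≃M-trans A≃B (≃M-sym (scaleM-identity B))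

∼-refl : ∀ {A} → A ∼ A
∼-refl = ≃M⇒∼ ≃M-refl

∼-sym : ∀ {A B} → A ∼ B → B ∼ A
∼-sym {A} {B} (s , N , A≃uB) = s , ℤ.- N , (begin
  B                                          ≈⟨ scaleM-identity B ⟨
  scaleM 1L B                                ≈⟨ scaleM-congˡ B (unit-inverseˡ s N) ⟨
  scaleM (unit s (ℤ.- N) *L unit s N) B      ≈⟨ scaleM-scaleM (unit s (ℤ.- N)) (unit s N) B ⟨
  scaleM (unit s (ℤ.- N)) (scaleM (unit s N) B) ≈⟨ scaleM-congʳ (unit s (ℤ.- N)) A≃uB ⟨
  scaleM (unit s (ℤ.- N)) A                  ∎)
  where open SetoidReasoning ≃M-setoid

∼-trans : ∀ {A B C} → A ∼ B → B ∼ C → A ∼ C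
∼-trans {A} {B} {C} (s , N , A≃uB) (t , M , B≃vC) = s Sign.* t , N ℤ.+ M , (begin
  A                                              ≈⟨ A≃uB ⟩
  scaleM (unit s N) B                            ≈⟨ scaleM-congʳ (unit s N) B≃vC ⟩
  scaleM (unit s N) (scaleM (unit t M) C)        ≈⟨ scaleM-scaleM (unit s N) (unit t M) C ⟩
  scaleM (unit s N *L unit t M) C                ≈⟨ scaleM-congˡ C (unit-* s N t M) ⟩
  scaleM (unit (s Sign.* t) (N ℤ.+ M)) C         ∎)
  where open SetoidReasoning ≃M-setoid

∼-congˡ : ∀ G {A B} → A ∼ B → G *M A ∼ G *M B
∼-congˡ G {B = B} (s , N , A≃uB) = s , N , ≃M-trans (*M-cong (≃M-refl {G}) A≃uB) (*M-scaleM G (unit s N) B)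

≈PGL⇒∼ : ∀ {A B} → A ≈PGL B → A ∼ B
≈PGL⇒∼ (s , N , a , b , c , d) = s , N , entrywise (crosswise (coeffwise a)) (crosswise (coeffwise b))
                                                   (crosswise (coeffwise c)) (crosswise (coeffwise d))

∼⇒≈PGL : ∀ {A B} → A ∼ B → A ≈PGL B
∼⇒≈PGL (s , N , entrywise a b c d) = s , N , coeff-≡ (cross a) , coeff-≡ (cross b) , coeff-≡ (cross c) , coeff-≡ (cross d)

-- R_q S_q does not depend on q
T : M2L
T = mat 1L (-L 1L) 1L 0L

module _ where
  open LaurentSolver using (Polynomial; var; con; _:*_; :-_)

  private
    X : PolyMat 6
    X = pmat (var (# 0)) (var (# 1)) (var (# 2)) (var (# 3))
    q′ q⁻¹′ 0′ 1′ : Polynomial 6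
    q′   = var (# 4)
    q⁻¹′ = var (# 5)
    0′   = con +0
    1′   = con (+ 1)
    Rq′ Sq′ RqInv′ SqInv′ T′ : PolyMat 6
    Rq′    = pmat q′ 1′ 0′ 1′
    Sq′    = pmat 0′ (:- q⁻¹′) 1′ 0′
    RqInv′ = pmat q⁻¹′ (:- q⁻¹′) 0′ 1′
    SqInv′ = pmat 0′ 1′ (:- q′) 0′
    T′     = pmat 1′ (:- 1′) 1′ 0′

    env : M2L → Vec Laurent 6
    env (mat x₁₁ x₁₂ x₂₁ x₂₂) = x₁₁ ∷ x₁₂ ∷ x₂₁ ∷ x₂₂ ∷ q ∷ qInv ∷ []

    -- The solver treats q and q⁻¹ as independent; these mark where q·q⁻¹ = 1 is needed.
    Tᵤ SqInvᵤ : Polynomial 6 → PolyMat 6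
    Tᵤ u      = pmat 1′ (:- u) 1′ 0′
    SqInvᵤ u  = pmat (u :* var (# 2)) (u :* var (# 3)) ((:- q′) :* var (# 0)) ((:- q′) :* var (# 1))

  Sq-Sq : ∀ A → Sq *M (Sq *M A) ≃M scaleM (-L qInv) A
  Sq-Sq A = proveM (env A) (Sq′ ⊗ (Sq′ ⊗ X)) ((:- q⁻¹′) ⊙ X) ≃M-refl

  Rq-Sq : ∀ A → Rq *M (Sq *M A) ≃M T *M A
  Rq-Sq A = begin
    Rq *M (Sq *M A)                    ≈⟨ proveM (env A) (Rq′ ⊗ (Sq′ ⊗ X)) (Tᵤ (q′ :* q⁻¹′) ⊗ X) ≃M-refl ⟩
    ⟦ Tᵤ (q′ :* q⁻¹′) ⟧M (env A) *M A
      ≈⟨ *M-cong (entrywise (≃-refl {1L}) (-L-cong q*qInv≃1) (≃-refl {1L}) (≃-refl {0L})) (≃M-refl {A}) ⟩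
    T *M A                             ∎
    where open SetoidReasoning ≃M-setoid

  T-T-T : ∀ A → T *M (T *M (T *M A)) ≃M scaleM (-L 1L) A
  T-T-T A = proveM (env A) (T′ ⊗ (T′ ⊗ (T′ ⊗ X))) ((:- 1′) ⊙ X) ≃M-refl

  SqInv≃Sq : ∀ A → SqInv *M A ≃M scaleM (-L q) (Sq *M A)
  SqInv≃Sq A@(mat _ _ a₂₁ a₂₂) = begin
    SqInv *M A                ≈⟨ proveM (env A) (SqInv′ ⊗ X) (SqInvᵤ 1′) ≃M-refl ⟩
    ⟦ SqInvᵤ 1′ ⟧M (env A)
      ≈⟨ entrywise (*L-cong (≃-sym q*qInv≃1) (≃-refl {a₂₁})) (*L-cong (≃-sym q*qInv≃1) (≃-refl {a₂₂})) ≃-refl ≃-refl ⟩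
    ⟦ SqInvᵤ (q′ :* q⁻¹′) ⟧M (env A)
      ≈⟨ proveM (env A) (SqInvᵤ (q′ :* q⁻¹′)) ((:- q′) ⊙ (Sq′ ⊗ X)) ≃M-refl ⟩
    scaleM (-L q) (Sq *M A)   ∎
    where open SetoidReasoning ≃M-setoid

  RqInv≃Sq-T-T : ∀ A → RqInv *M A ≃M scaleM (-L 1L) (Sq *M (T *M (T *M A)))
  RqInv≃Sq-T-T A = proveM (env A) (RqInv′ ⊗ X) ((:- 1′) ⊙ (Sq′ ⊗ (T′ ⊗ (T′ ⊗ X)))) ≃M-refl

Sq-Sq∼ : ∀ A → Sq *M (Sq *M A) ∼ A
Sq-Sq∼ A = Sign.- , -[1+ 0 ] , Sq-Sq A

SqInv∼Sq : ∀ A → SqInv *M A ∼ Sq *M A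
SqInv∼Sq A = Sign.- , + 1 , SqInv≃Sq A

RqSq-RqSq : ∀ A → Rq *M (Sq *M (Rq *M (Sq *M A))) ≃M T *M (T *M A)
RqSq-RqSq A = ≃M-trans (Rq-Sq (Rq *M (Sq *M A))) (*M-cong (≃M-refl {T}) (Rq-Sq A))

RqSq-cube : ∀ A → Rq *M (Sq *M (Rq *M (Sq *M (Rq *M (Sq *M A))))) ∼ A
RqSq-cube A = Sign.- , +0 , (begin
  Rq *M (Sq *M (Rq *M (Sq *M (Rq *M (Sq *M A)))))  ≈⟨ Rq-Sq (Rq *M (Sq *M (Rq *M (Sq *M A)))) ⟩
  T *M (Rq *M (Sq *M (Rq *M (Sq *M A))))           ≈⟨ *M-cong (≃M-refl {T}) (RqSq-RqSq A) ⟩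
  T *M (T *M (T *M A))                             ≈⟨ T-T-T A ⟩
  scaleM (-L 1L) A                                 ∎)
  where open SetoidReasoning ≃M-setoid

RqInv∼Sq-RqSq-RqSq : ∀ A → RqInv *M A ∼ Sq *M (Rq *M (Sq *M (Rq *M (Sq *M A))))
RqInv∼Sq-RqSq-RqSq A = Sign.- , +0 , (begin
  RqInv *M A                                               ≈⟨ RqInv≃Sq-T-T A ⟩
  scaleM (-L 1L) (Sq *M (T *M (T *M A)))                   ≈⟨ scaleM-congʳ (-L 1L) (*M-cong (≃M-refl {Sq}) (RqSq-RqSq A)) ⟨
  scaleM (-L 1L) (Sq *M (Rq *M (Sq *M (Rq *M (Sq *M A)))))  ∎)
  where open SetoidReasoning ≃M-setoid

-- Normal forms of words

data Block : Set where
  R-block L-block : Block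

data Tpow : Set where
  T⁰ T¹ T² : Tpow

-- S^s W T^t with W a word in R and R S R: the normal form of PSL(2,ℤ) ≅ ℤ/2 ∗ ℤ/3 in S and T = R S.
record NormalForm : Set where
  constructor nf
  field
    leadingS  : Bool
    body      : List Block
    trailingT : Tpow

blocksWord : List Block → List Gen
blocksWord []              = []
blocksWord (R-block ∷ W)   = R ∷ blocksWord W
blocksWord (L-block ∷ W)   = R ∷ S ∷ R ∷ blocksWord W

TWord : Tpow → List Gen
TWord T⁰ = []
TWord T¹ = R ∷ S ∷ []
TWord T² = R ∷ S ∷ R ∷ S ∷ []

word : NormalForm → List Gen
word (nf false W t) = blocksWord W ++ TWord t
word (nf true  W t) = S ∷ blocksWord W ++ TWord t

actS : NormalForm → NormalForm
actS (nf s W t) = nf (not s) W t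

actT : NormalForm → NormalForm
actT (nf true  W             t)  = nf false (R-block ∷ W) t
actT (nf false (R-block ∷ W) t)  = nf false (L-block ∷ W) t
actT (nf false (L-block ∷ W) t)  = nf true W t
actT (nf false []            T⁰) = nf false [] T¹
actT (nf false []            T¹) = nf false [] T²
actT (nf false []            T²) = nf false [] T⁰

-- R = T S⁻¹ and R⁻¹ = S T⁻¹ projectively
act : Gen → NormalForm → NormalForm
act R  n = actT (actS n)
act R⁻ n = actS (actT (actT n))
act S  n = actS n
act S⁻ n = actS n

actWord : List Gen → NormalForm → NormalForm
actWord w n = foldr act n w

nf-ε : NormalForm
nf-ε = nf false [] T⁰

normalForm : List Gen → NormalForm
normalForm w = actWord w nf-ε

actS-involutive : ∀ n → actS (actS n) ≡ n
actS-involutive (nf false W t) = refl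
actS-involutive (nf true  W t) = refl

actT-cube : ∀ n → actT (actT (actT n)) ≡ n
actT-cube (nf true  W             t)  = refl
actT-cube (nf false (R-block ∷ W) t)  = refl
actT-cube (nf false (L-block ∷ W) t)  = refl
actT-cube (nf false []            T⁰) = refl
actT-cube (nf false []            T¹) = refl
actT-cube (nf false []            T²) = refl

act-invGen : ∀ g n → act g (act (invGen g) n) ≡ n
act-invGen R  n = trans (cong actT (actS-involutive (actT (actT n)))) (actT-cube n)
act-invGen R⁻ n = trans (cong actS (actT-cube (actS n))) (actS-involutive n)
act-invGen S  n = actS-involutive n
act-invGen S⁻ n = actS-involutive n

inverseWord : List Gen → List Gen
inverseWord w = reverse (map invGen w)

actWord-inverse : ∀ w n → actWord w (actWord (inverseWord w) n) ≡ n
actWord-inverse []      n = refl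
actWord-inverse (g ∷ w) n = begin
  act g (actWord w (actWord (reverse (invGen g ∷ map invGen w)) n))
    ≡⟨ cong (λ v → act g (actWord w (actWord v n))) (ListP.unfold-reverse (invGen g) (map invGen w)) ⟩
  act g (actWord w (actWord (inverseWord w ++ invGen g ∷ []) n))
    ≡⟨ cong (λ m → act g (actWord w m)) (ListP.foldr-++ act n (inverseWord w) (invGen g ∷ [])) ⟩
  act g (actWord w (actWord (inverseWord w) (act (invGen g) n)))
    ≡⟨ cong (act g) (actWord-inverse w (act (invGen g) n)) ⟩
  act g (act (invGen g) n)
    ≡⟨ act-invGen g n ⟩
  n ∎
  where open ≡-Reasoning

stepS : ∀ n → Sq *M eval (word n) ∼ eval (word (actS n))
stepS (nf false W t) = ∼-refl
stepS (nf true  W t) = Sq-Sq∼ (eval (blocksWord W ++ TWord t))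

stepT : ∀ n → Rq *M (Sq *M eval (word n)) ∼ eval (word (actT n))
stepT (nf true  W             t)  = ∼-congˡ Rq (Sq-Sq∼ (eval (blocksWord W ++ TWord t)))
stepT (nf false (R-block ∷ W) t)  = ∼-refl
stepT (nf false (L-block ∷ W) t)  =
  ∼-trans (∼-congˡ Rq (∼-congˡ Sq (∼-congˡ Rq (∼-congˡ Sq (∼-congˡ Rq (∼-sym (Sq-Sq∼ A)))))))
          (RqSq-cube (Sq *M A))
  where A = eval (blocksWord W ++ TWord t)
stepT (nf false []            T⁰) = ∼-refl
stepT (nf false []            T¹) = ∼-refl
stepT (nf false []            T²) = RqSq-cube IdM

step : ∀ g n → genM g *M eval (word n) ∼ eval (word (act g n))
step S  n = stepS n
step S⁻ n = ∼-trans (SqInv∼Sq (eval (word n))) (stepS n)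
step R  n = ∼-trans (∼-congˡ Rq (∼-sym (Sq-Sq∼ (eval (word n)))))
           (∼-trans (∼-congˡ Rq (∼-congˡ Sq (stepS n))) (stepT (actS n)))
step R⁻ n = ∼-trans (RqInv∼Sq-RqSq-RqSq (eval (word n)))
           (∼-trans (∼-congˡ Sq (∼-congˡ Rq (∼-congˡ Sq (stepT n))))
           (∼-trans (∼-congˡ Sq (stepT (actT n))) (stepS (actT (actT n)))))

eval∼normalForm : ∀ w → eval w ∼ eval (word (normalForm w))
eval∼normalForm []      = ∼-refl
eval∼normalForm (g ∷ w) = ∼-trans (∼-congˡ (genM g) (eval∼normalForm w)) (step g (normalForm w))

-- Specialisation at q = 1

sumP : Poly → ℤ
sumP []      = +0
sumP (a ∷ p) = a ℤ.+ sumP p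

sumP-zero : ∀ {p} → p ≋ [] → sumP p ≡ +0
sumP-zero {[]}    p≋[] = refl
sumP-zero {a ∷ p} p≋[] = cong₂ ℤ._+_ (coeff-≡ p≋[] 0) (sumP-zero {p} (coeffwise λ k → coeff-≡ p≋[] (suc k)))

sumP-cong : ∀ {p r} → p ≋ r → sumP p ≡ sumP r
sumP-cong {[]}    {r}     p≋r = sym (sumP-zero (≋-sym p≋r))
sumP-cong {a ∷ p} {[]}    p≋r = sumP-zero p≋r
sumP-cong {a ∷ p} {b ∷ r} p≋r = cong₂ ℤ._+_ (coeff-≡ p≋r 0) (sumP-cong {p} {r} (∷-injective p≋r))

sumP-shiftP : ∀ n p → sumP (shiftP n p) ≡ sumP p
sumP-shiftP zero    p = refl
sumP-shiftP (suc n) p = trans (ℤP.+-identityˡ _) (sumP-shiftP n p)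

sumP-addP : ∀ p r → sumP (addP p r) ≡ sumP p ℤ.+ sumP r
sumP-addP []      r       = sym (ℤP.+-identityˡ _)
sumP-addP (a ∷ p) []      = sym (ℤP.+-identityʳ _)
sumP-addP (a ∷ p) (b ∷ r) = trans (cong (λ z → a ℤ.+ b ℤ.+ z) (sumP-addP p r)) (interchange a b (sumP p) (sumP r))
  where
  interchange : ∀ a b x y → a ℤ.+ b ℤ.+ (x ℤ.+ y) ≡ a ℤ.+ x ℤ.+ (b ℤ.+ y)
  interchange = ℤSolver.solve-∀

sumP-map : ∀ (f : ℤ → ℤ) → f +0 ≡ +0 → (∀ x y → f (x ℤ.+ y) ≡ f x ℤ.+ f y) →
           ∀ p → sumP (map f p) ≡ f (sumP p)
sumP-map f f0≡0 f-+ []      = sym f0≡0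
sumP-map f f0≡0 f-+ (a ∷ p) = trans (cong (λ z → f a ℤ.+ z) (sumP-map f f0≡0 f-+ p)) (sym (f-+ a (sumP p)))

sumP-mulP : ∀ p r → sumP (mulP p r) ≡ sumP p ℤ.* sumP r
sumP-mulP []      r = refl
sumP-mulP (a ∷ p) r = begin
  sumP (addP (map (a ℤ.*_) r) (+0 ∷ mulP p r))     ≡⟨ sumP-addP (map (a ℤ.*_) r) (+0 ∷ mulP p r) ⟩
  sumP (map (a ℤ.*_) r) ℤ.+ (+0 ℤ.+ sumP (mulP p r)) ≡⟨ cong₂ ℤ._+_ (sumP-map (a ℤ.*_) (ℤP.*-zeroʳ a) (ℤP.*-distribˡ-+ a) r)
                                                                 (trans (ℤP.+-identityˡ _) (sumP-mulP p r)) ⟩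
  a ℤ.* sumP r ℤ.+ sumP p ℤ.* sumP r              ≡⟨ ℤP.*-distribʳ-+ (sumP r) a (sumP p) ⟨
  (a ℤ.+ sumP p) ℤ.* sumP r                       ∎
  where open ≡-Reasoning

at1 : Laurent → ℤ
at1 x = sumP (poly x)

at1-cong : ∀ {x y} → x ≃ y → at1 x ≡ at1 y
at1-cong {lp N p} {lp M r} (crosswise Mp≋Nr) = trans (sym (sumP-shiftP M p)) (trans (sumP-cong Mp≋Nr) (sumP-shiftP N r))

at1-+ : ∀ x y → at1 (x +L y) ≡ at1 x ℤ.+ at1 y
at1-+ (lp N p) (lp M r) = trans (sumP-addP (shiftP M p) (shiftP N r)) (cong₂ ℤ._+_ (sumP-shiftP M p) (sumP-shiftP N r))

at1-* : ∀ x y → at1 (x *L y) ≡ at1 x ℤ.* at1 y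
at1-* (lp N p) (lp M r) = sumP-mulP p r

at1-unit : ∀ s N → at1 (unit s N) ≡ s ℤ.◃ 1
at1-unit s N rewrite unit-signed s N | qPow-monomial N with s
... | Sign.+ = sumP-shiftP (N ⁺) (+ 1 ∷ [])
... | Sign.- = trans (sumP-map ℤ.-_ refl ℤP.neg-distrib-+ (shiftP (N ⁺) (+ 1 ∷ [])))
                     (cong ℤ.-_ (sumP-shiftP (N ⁺) (+ 1 ∷ [])))

at1M : M2L → M2Z
at1M (mat a b c d) = matZ (at1 a) (at1 b) (at1 c) (at1 d)

matZ-cong : ∀ {a b c d a′ b′ c′ d′} → a ≡ a′ → b ≡ b′ → c ≡ c′ → d ≡ d′ →
            matZ a b c d ≡ matZ a′ b′ c′ d′
matZ-cong refl refl refl refl = refl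

at1M-cong : ∀ {A B} → A ≃M B → at1M A ≡ at1M B
at1M-cong (entrywise a b c d) = matZ-cong (at1-cong a) (at1-cong b) (at1-cong c) (at1-cong d)

at1M-* : ∀ A B → at1M (A *M B) ≡ at1M A *Z at1M B
at1M-* (mat a b c d) (mat e f g h) = matZ-cong (entry a e b g) (entry a f b h) (entry c e d g) (entry c f d h)
  where
  entry : ∀ x y z w → at1 (x *L y +L z *L w) ≡ at1 x ℤ.* at1 y ℤ.+ at1 z ℤ.* at1 w
  entry x y z w = trans (at1-+ (x *L y) (z *L w)) (cong₂ ℤ._+_ (at1-* x y) (at1-* z w))

infix 4 _≈±_
_≈±_ : M2Z → M2Z → Set
A ≈± B = (A ≡ B) ⊎ (A ≡ negZ B)

at1M-scaleM-unit : ∀ s N A → at1M (scaleM (unit s N) A) ≈± at1M A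
at1M-scaleM-unit s N (mat a b c d) with s | at1-unit s N
... | Sign.+ | u≡1  = inj₁ (matZ-cong (entry a) (entry b) (entry c) (entry d))
  where
  entry : ∀ x → at1 (unit Sign.+ N *L x) ≡ at1 x
  entry x = trans (at1-* (unit Sign.+ N) x) (trans (cong (ℤ._* at1 x) u≡1) (ℤP.*-identityˡ (at1 x)))
... | Sign.- | u≡-1 = inj₂ (matZ-cong (entry a) (entry b) (entry c) (entry d))
  where
  entry : ∀ x → at1 (unit Sign.- N *L x) ≡ ℤ.- at1 x
  entry x = trans (at1-* (unit Sign.- N) x) (trans (cong (ℤ._* at1 x) u≡-1) (ℤP.-1*i≡-i (at1 x)))

∼⇒≈± : ∀ {A B} → A ∼ B → at1M A ≈± at1M B
∼⇒≈± {A} {B} (s , N , A≃uB) rewrite at1M-cong A≃uB = at1M-scaleM-unit s N B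

I Rz Sz Lz : M2Z
I  = matZ (+ 1) (+ 0) (+ 0) (+ 1)
Rz = matZ (+ 1) (+ 1) (+ 0) (+ 1)
Sz = matZ (+ 0) -[1+ 0 ] (+ 1) (+ 0)
Lz = matZ (+ 1) (+ 0) (+ 1) (+ 1)

*Z-assoc : ∀ X Y Z → (X *Z Y) *Z Z ≡ X *Z (Y *Z Z)
*Z-assoc (matZ a b c d) (matZ e f g h) (matZ i j k l) =
  matZ-cong (entry a b e f g h i k) (entry a b e f g h j l) (entry c d e f g h i k) (entry c d e f g h j l)
  where
  entry : ∀ a b e f g h i k →
          (a ℤ.* e ℤ.+ b ℤ.* g) ℤ.* i ℤ.+ (a ℤ.* f ℤ.+ b ℤ.* h) ℤ.* k ≡
          a ℤ.* (e ℤ.* i ℤ.+ f ℤ.* k) ℤ.+ b ℤ.* (g ℤ.* i ℤ.+ h ℤ.* k)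
  entry = ℤSolver.solve-∀

*Z-identityˡ : ∀ X → I *Z X ≡ X
*Z-identityˡ (matZ a b c d) = matZ-cong (entry a c) (entry b d) (entry′ a c) (entry′ b d)
  where
  entry : ∀ x y → + 1 ℤ.* x ℤ.+ + 0 ℤ.* y ≡ x
  entry = ℤSolver.solve-∀
  entry′ : ∀ x y → + 0 ℤ.* x ℤ.+ + 1 ℤ.* y ≡ y
  entry′ = ℤSolver.solve-∀

*Z-identityʳ : ∀ X → X *Z I ≡ X
*Z-identityʳ (matZ a b c d) = matZ-cong (entry a b) (entry′ a b) (entry c d) (entry′ c d)
  where
  entry : ∀ x y → x ℤ.* + 1 ℤ.+ y ℤ.* + 0 ≡ x
  entry = ℤSolver.solve-∀
  entry′ : ∀ x y → x ℤ.* + 0 ℤ.+ y ℤ.* + 1 ≡ y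
  entry′ = ℤSolver.solve-∀

*Z-negZʳ : ∀ X Y → X *Z negZ Y ≡ negZ (X *Z Y)
*Z-negZʳ (matZ a b c d) (matZ e f g h) = matZ-cong (entry a e b g) (entry a f b h) (entry c e d g) (entry c f d h)
  where
  entry : ∀ x y z w → x ℤ.* ℤ.- y ℤ.+ z ℤ.* ℤ.- w ≡ ℤ.- (x ℤ.* y ℤ.+ z ℤ.* w)
  entry = ℤSolver.solve-∀

negZ-involutive : ∀ X → negZ (negZ X) ≡ X
negZ-involutive (matZ a b c d) =
  matZ-cong (ℤP.neg-involutive a) (ℤP.neg-involutive b) (ℤP.neg-involutive c) (ℤP.neg-involutive d)

adjZ-*Z : ∀ X Y → adjZ (X *Z Y) ≡ adjZ Y *Z adjZ X
adjZ-*Z (matZ a b c d) (matZ e f g h) =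
  matZ-cong (e₁₁ c d f h) (e₁₂ a b f h) (e₂₁ c d e g) (e₂₂ a b e g)
  where
  e₁₁ : ∀ c d f h → c ℤ.* f ℤ.+ d ℤ.* h ≡ h ℤ.* d ℤ.+ ℤ.- f ℤ.* ℤ.- c
  e₁₁ = ℤSolver.solve-∀
  e₁₂ : ∀ a b f h → ℤ.- (a ℤ.* f ℤ.+ b ℤ.* h) ≡ h ℤ.* ℤ.- b ℤ.+ ℤ.- f ℤ.* a
  e₁₂ = ℤSolver.solve-∀
  e₂₁ : ∀ c d e g → ℤ.- (c ℤ.* e ℤ.+ d ℤ.* g) ≡ ℤ.- g ℤ.* d ℤ.+ e ℤ.* ℤ.- c
  e₂₁ = ℤSolver.solve-∀
  e₂₂ : ∀ a b e g → a ℤ.* e ℤ.+ b ℤ.* g ≡ ℤ.- g ℤ.* ℤ.- b ℤ.+ e ℤ.* a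
  e₂₂ = ℤSolver.solve-∀

adjZ-inverseˡ : ∀ X → detZ X ≡ + 1 → adjZ X *Z X ≡ I
adjZ-inverseˡ (matZ a b c d) det≡1 =
  matZ-cong (trans (diag₁ a b c d) det≡1) (offdiag b d) (offdiag′ a c) (trans (diag₂ a b c d) det≡1)
  where
  diag₁ : ∀ a b c d → d ℤ.* a ℤ.+ ℤ.- b ℤ.* c ≡ a ℤ.* d ℤ.- b ℤ.* c
  diag₁ = ℤSolver.solve-∀
  diag₂ : ∀ a b c d → ℤ.- c ℤ.* b ℤ.+ a ℤ.* d ≡ a ℤ.* d ℤ.- b ℤ.* c
  diag₂ = ℤSolver.solve-∀
  offdiag : ∀ b d → d ℤ.* b ℤ.+ ℤ.- b ℤ.* d ≡ + 0
  offdiag = ℤSolver.solve-∀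
  offdiag′ : ∀ a c → ℤ.- c ℤ.* a ℤ.+ a ℤ.* c ≡ + 0
  offdiag′ = ℤSolver.solve-∀

genZ : Gen → M2Z
genZ R  = Rz
genZ R⁻ = matZ (+ 1) -[1+ 0 ] (+ 0) (+ 1)
genZ S  = Sz
genZ S⁻ = matZ (+ 0) (+ 1) -[1+ 0 ] (+ 0)

evalZ : List Gen → M2Z
evalZ []      = I
evalZ (g ∷ w) = genZ g *Z evalZ w

at1M-genM : ∀ g → at1M (genM g) ≡ genZ g
at1M-genM R  = refl
at1M-genM R⁻ = refl
at1M-genM S  = refl
at1M-genM S⁻ = refl

at1M-eval : ∀ w → at1M (eval w) ≡ evalZ w
at1M-eval []      = refl
at1M-eval (g ∷ w) = trans (at1M-* (genM g) (eval w)) (cong₂ _*Z_ (at1M-genM g) (at1M-eval w))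

evalZ-++ : ∀ u v → evalZ (u ++ v) ≡ evalZ u *Z evalZ v
evalZ-++ []      v = sym (*Z-identityˡ (evalZ v))
evalZ-++ (g ∷ u) v = trans (cong (genZ g *Z_) (evalZ-++ u v)) (sym (*Z-assoc (genZ g) (evalZ u) (evalZ v)))

adjZ-genZ : ∀ g → adjZ (genZ g) ≡ genZ (invGen g)
adjZ-genZ R  = refl
adjZ-genZ R⁻ = refl
adjZ-genZ S  = refl
adjZ-genZ S⁻ = refl

evalZ-inverseWord : ∀ w → evalZ (inverseWord w) ≡ adjZ (evalZ w)
evalZ-inverseWord []      = refl
evalZ-inverseWord (g ∷ w) = begin
  evalZ (reverse (invGen g ∷ map invGen w))            ≡⟨ cong evalZ (ListP.unfold-reverse (invGen g) (map invGen w)) ⟩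
  evalZ (inverseWord w ++ invGen g ∷ [])               ≡⟨ evalZ-++ (inverseWord w) (invGen g ∷ []) ⟩
  evalZ (inverseWord w) *Z (genZ (invGen g) *Z I)      ≡⟨ cong₂ _*Z_ (evalZ-inverseWord w) (*Z-identityʳ (genZ (invGen g))) ⟩
  adjZ (evalZ w) *Z genZ (invGen g)                    ≡⟨ cong (adjZ (evalZ w) *Z_) (adjZ-genZ g) ⟨
  adjZ (evalZ w) *Z adjZ (genZ g)                      ≡⟨ adjZ-*Z (genZ g) (evalZ w) ⟨
  adjZ (genZ g *Z evalZ w)                             ∎
  where open ≡-Reasoning

detZ-genZ : ∀ g → detZ (genZ g) ≡ + 1
detZ-genZ R  = refl
detZ-genZ R⁻ = refl
detZ-genZ S  = refl
detZ-genZ S⁻ = refl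

detZ-evalZ : ∀ w → detZ (evalZ w) ≡ + 1
detZ-evalZ []      = refl
detZ-evalZ (g ∷ w) = trans (detZ-* (genZ g) (evalZ w)) (cong₂ ℤ._*_ (detZ-genZ g) (detZ-evalZ w))

≈±-trans : ∀ {A B C} → A ≈± B → B ≈± C → A ≈± C
≈±-trans         (inj₁ A≡B)  (inj₁ B≡C)  = inj₁ (trans A≡B B≡C)
≈±-trans         (inj₁ A≡B)  (inj₂ B≡-C) = inj₂ (trans A≡B B≡-C)
≈±-trans         (inj₂ A≡-B) (inj₁ B≡C)  = inj₂ (trans A≡-B (cong negZ B≡C))
≈±-trans {C = C} (inj₂ A≡-B) (inj₂ B≡-C) = inj₁ (trans A≡-B (trans (cong negZ B≡-C) (negZ-involutive C)))

≈±-congˡ : ∀ X {A B} → A ≈± B → X *Z A ≈± X *Z B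
≈±-congˡ X         (inj₁ A≡B)  = inj₁ (cong (X *Z_) A≡B)
≈±-congˡ X {B = B} (inj₂ A≡-B) = inj₂ (trans (cong (X *Z_) A≡-B) (*Z-negZʳ X B))

∼⇒evalZ-≈± : ∀ v w → eval v ∼ eval w → evalZ v ≈± evalZ w
∼⇒evalZ-≈± v w v∼w = subst₂ _≈±_ (at1M-eval v) (at1M-eval w) (∼⇒≈± v∼w)

-- Normal forms are determined by their image in PSL(2, ℤ)

Sz-*Z : ∀ a b c d → Sz *Z matZ a b c d ≡ matZ (ℤ.- c) (ℤ.- d) a b
Sz-*Z a b c d = matZ-cong (e₁ a c) (e₁ b d) (e₂ a c) (e₂ b d)
  where
  e₁ : ∀ x y → + 0 ℤ.* x ℤ.+ -[1+ 0 ] ℤ.* y ≡ ℤ.- y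
  e₁ = ℤSolver.solve-∀
  e₂ : ∀ x y → + 1 ℤ.* x ℤ.+ + 0 ℤ.* y ≡ x
  e₂ = ℤSolver.solve-∀

*Z-Sz : ∀ a b c d → matZ a b c d *Z Sz ≡ matZ b (ℤ.- a) d (ℤ.- c)
*Z-Sz a b c d = matZ-cong (e₁ a b) (e₂ a b) (e₁ c d) (e₂ c d)
  where
  e₁ : ∀ x y → x ℤ.* + 0 ℤ.+ y ℤ.* + 1 ≡ y
  e₁ = ℤSolver.solve-∀
  e₂ : ∀ x y → x ℤ.* -[1+ 0 ] ℤ.+ y ℤ.* + 0 ≡ ℤ.- x
  e₂ = ℤSolver.solve-∀

Rz-*Z : ∀ a b c d → Rz *Z matZ a b c d ≡ matZ (a ℤ.+ c) (b ℤ.+ d) c d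
Rz-*Z a b c d = matZ-cong (e₁ a c) (e₁ b d) (e₂ a c) (e₂ b d)
  where
  e₁ : ∀ x y → + 1 ℤ.* x ℤ.+ + 1 ℤ.* y ≡ x ℤ.+ y
  e₁ = ℤSolver.solve-∀
  e₂ : ∀ x y → + 0 ℤ.* x ℤ.+ + 1 ℤ.* y ≡ y
  e₂ = ℤSolver.solve-∀

Lz-*Z : ∀ a b c d → Lz *Z matZ a b c d ≡ matZ a b (a ℤ.+ c) (d ℤ.+ b)
Lz-*Z a b c d = matZ-cong (e₁ a c) (e₁ b d) (e₂ a c) (e₃ b d)
  where
  e₁ : ∀ x y → + 1 ℤ.* x ℤ.+ + 0 ℤ.* y ≡ x
  e₁ = ℤSolver.solve-∀
  e₂ : ∀ x y → + 1 ℤ.* x ℤ.+ + 1 ℤ.* y ≡ x ℤ.+ y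
  e₂ = ℤSolver.solve-∀
  e₃ : ∀ x y → + 1 ℤ.* x ℤ.+ + 1 ℤ.* y ≡ y ℤ.+ x
  e₃ = ℤSolver.solve-∀

*Z-Rz : ∀ a b c d → matZ a b c d *Z Rz ≡ matZ a (a ℤ.+ b) c (d ℤ.+ c)
*Z-Rz a b c d = matZ-cong (e₁ a b) (e₂ a b) (e₁ c d) (e₃ c d)
  where
  e₁ : ∀ x y → x ℤ.* + 1 ℤ.+ y ℤ.* + 0 ≡ x
  e₁ = ℤSolver.solve-∀
  e₂ : ∀ x y → x ℤ.* + 1 ℤ.+ y ℤ.* + 1 ≡ x ℤ.+ y
  e₂ = ℤSolver.solve-∀
  e₃ : ∀ x y → x ℤ.* + 1 ℤ.+ y ℤ.* + 1 ≡ y ℤ.+ x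
  e₃ = ℤSolver.solve-∀

*Z-Lz : ∀ a b c d → matZ a b c d *Z Lz ≡ matZ (a ℤ.+ b) b (c ℤ.+ d) d
*Z-Lz a b c d = matZ-cong (e₁ a b) (e₂ a b) (e₁ c d) (e₂ c d)
  where
  e₁ : ∀ x y → x ℤ.* + 1 ℤ.+ y ℤ.* + 1 ≡ x ℤ.+ y
  e₁ = ℤSolver.solve-∀
  e₂ : ∀ x y → x ℤ.* + 0 ℤ.+ y ℤ.* + 1 ≡ y
  e₂ = ℤSolver.solve-∀

Rz-Sz-Rz : ∀ X → Rz *Z (Sz *Z (Rz *Z X)) ≡ Lz *Z X
Rz-Sz-Rz (matZ a b c d) = begin
  Rz *Z (Sz *Z (Rz *Z matZ a b c d))      ≡⟨ cong (λ Y → Rz *Z (Sz *Z Y)) (Rz-*Z a b c d) ⟩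
  Rz *Z (Sz *Z matZ (a ℤ.+ c) (b ℤ.+ d) c d) ≡⟨ cong (Rz *Z_) (Sz-*Z (a ℤ.+ c) (b ℤ.+ d) c d) ⟩
  Rz *Z matZ (ℤ.- c) (ℤ.- d) (a ℤ.+ c) (b ℤ.+ d) ≡⟨ Rz-*Z (ℤ.- c) (ℤ.- d) (a ℤ.+ c) (b ℤ.+ d) ⟩
  matZ (ℤ.- c ℤ.+ (a ℤ.+ c)) (ℤ.- d ℤ.+ (b ℤ.+ d)) (a ℤ.+ c) (b ℤ.+ d)
    ≡⟨ matZ-cong (cancel c a) (cancel d b) refl (ℤP.+-comm b d) ⟩
  matZ a b (a ℤ.+ c) (d ℤ.+ b)            ≡⟨ Lz-*Z a b c d ⟨
  Lz *Z matZ a b c d                      ∎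
  where
  open ≡-Reasoning
  cancel : ∀ x y → ℤ.- x ℤ.+ (y ℤ.+ x) ≡ y
  cancel = ℤSolver.solve-∀

blockZ : Block → M2Z
blockZ R-block = Rz
blockZ L-block = Lz

evalZ-blocksWord-∷ : ∀ x W → evalZ (blocksWord (x ∷ W)) ≡ blockZ x *Z evalZ (blocksWord W)
evalZ-blocksWord-∷ R-block W = refl
evalZ-blocksWord-∷ L-block W = Rz-Sz-Rz (evalZ (blocksWord W))

data Positive : M2Z → Set where
  positive : ∀ p q r u → Positive (matZ +[1+ p ] (+ q) (+ r) +[1+ u ])

Diagonal : M2Z → Set
Diagonal M = M2Z.e12 M ≡ +0 × M2Z.e21 M ≡ +0

blockZ-*Z-positive : ∀ x {M} → Positive M → Positive (blockZ x *Z M)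
blockZ-*Z-positive R-block (positive p q r u) =
  subst Positive (sym (Rz-*Z +[1+ p ] (+ q) (+ r) +[1+ u ])) (positive (p ℕ.+ r) (q ℕ.+ suc u) r u)
blockZ-*Z-positive L-block (positive p q r u) =
  subst Positive (sym (Lz-*Z +[1+ p ] (+ q) (+ r) +[1+ u ])) (positive p q (suc (p ℕ.+ r)) (u ℕ.+ q))

*Z-blockZ-positive : ∀ x {M} → Positive M → Positive (M *Z blockZ x)
*Z-blockZ-positive R-block (positive p q r u) =
  subst Positive (sym (*Z-Rz +[1+ p ] (+ q) (+ r) +[1+ u ])) (positive p (suc (p ℕ.+ q)) r (u ℕ.+ r))
*Z-blockZ-positive L-block (positive p q r u) =
  subst Positive (sym (*Z-Lz +[1+ p ] (+ q) (+ r) +[1+ u ])) (positive (p ℕ.+ q) q (r ℕ.+ suc u) u)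

blockZ-*Z-nondiagonal : ∀ x {M} → Positive M → ¬ Diagonal (blockZ x *Z M)
blockZ-*Z-nondiagonal R-block (positive p q r u) d
  with e₁₂≡0 , _ ← subst Diagonal (Rz-*Z +[1+ p ] (+ q) (+ r) +[1+ u ]) d = ℕP.m+1+n≢0 q (ℤP.+-injective e₁₂≡0)
blockZ-*Z-nondiagonal L-block (positive p q r u) d
  with _ , () ← subst Diagonal (Lz-*Z +[1+ p ] (+ q) (+ r) +[1+ u ]) d

*Z-blockZ-nondiagonal : ∀ x {M} → Positive M → ¬ Diagonal (M *Z blockZ x)
*Z-blockZ-nondiagonal R-block (positive p q r u) d
  with () , _ ← subst Diagonal (*Z-Rz +[1+ p ] (+ q) (+ r) +[1+ u ]) d
*Z-blockZ-nondiagonal L-block (positive p q r u) d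
  with _ , e₂₁≡0 ← subst Diagonal (*Z-Lz +[1+ p ] (+ q) (+ r) +[1+ u ]) d = ℕP.m+1+n≢0 r (ℤP.+-injective e₂₁≡0)

Sz-*Z-nondiagonal : ∀ {M} → Positive M → ¬ Diagonal (Sz *Z M)
Sz-*Z-nondiagonal (positive p q r u) d with _ , () ← subst Diagonal (Sz-*Z +[1+ p ] (+ q) (+ r) +[1+ u ]) d

*Z-Sz-nondiagonal : ∀ {M} → Positive M → ¬ Diagonal (M *Z Sz)
*Z-Sz-nondiagonal (positive p q r u) d with () , _ ← subst Diagonal (*Z-Sz +[1+ p ] (+ q) (+ r) +[1+ u ]) d

Sz-conjugate-diagonal : ∀ M → Diagonal (Sz *Z (M *Z Sz)) → Diagonal M
Sz-conjugate-diagonal (matZ a b c d) diag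
  with e₁₂≡0 , e₂₁≡0 ← subst Diagonal (trans (cong (Sz *Z_) (*Z-Sz a b c d)) (Sz-*Z b (ℤ.- a) d (ℤ.- c))) diag =
  e₂₁≡0 , trans (sym (ℤP.neg-involutive c)) e₁₂≡0

blocks-positive : ∀ W → Positive (evalZ (blocksWord W))
blocks-positive []      = positive 0 0 0 0
blocks-positive (x ∷ W) = subst Positive (sym (evalZ-blocksWord-∷ x W)) (blockZ-*Z-positive x (blocks-positive W))

blocks-diagonal : ∀ W → Diagonal (evalZ (blocksWord W)) → W ≡ []
blocks-diagonal []      _ = refl
blocks-diagonal (x ∷ W) d =
  ⊥-elim (blockZ-*Z-nondiagonal x (blocks-positive W) (subst Diagonal (evalZ-blocksWord-∷ x W) d))

≈±I⇒diagonal : ∀ {M} → M ≈± I → Diagonal M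
≈±I⇒diagonal (inj₁ refl) = refl , refl
≈±I⇒diagonal (inj₂ refl) = refl , refl

-- Over ℤ, T = R S and T² = R S R S = L S
Tpow-of : Block → Tpow
Tpow-of R-block = T¹
Tpow-of L-block = T²

evalZ-body : ∀ W x → evalZ (blocksWord W ++ TWord (Tpow-of x)) ≡ (evalZ (blocksWord W) *Z blockZ x) *Z Sz
evalZ-body W x = begin
  evalZ (blocksWord W ++ TWord (Tpow-of x))        ≡⟨ evalZ-++ (blocksWord W) (TWord (Tpow-of x)) ⟩
  evalZ (blocksWord W) *Z evalZ (TWord (Tpow-of x)) ≡⟨ cong (evalZ (blocksWord W) *Z_) (TWord-Sz x) ⟩
  evalZ (blocksWord W) *Z (blockZ x *Z Sz)          ≡⟨ *Z-assoc (evalZ (blocksWord W)) (blockZ x) Sz ⟨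
  (evalZ (blocksWord W) *Z blockZ x) *Z Sz          ∎
  where
  open ≡-Reasoning
  TWord-Sz : ∀ x → evalZ (TWord (Tpow-of x)) ≡ blockZ x *Z Sz
  TWord-Sz R-block = cong (Rz *Z_) (*Z-identityʳ Sz)
  TWord-Sz L-block = trans (Rz-Sz-Rz (Sz *Z I)) (cong (Lz *Z_) (*Z-identityʳ Sz))

word≈±I⇒nf-ε : ∀ n → evalZ (word n) ≈± I → n ≡ nf-ε
word≈±I⇒nf-ε (nf false W T⁰) n≈±I =
  cong (λ V → nf false V T⁰) (blocks-diagonal W (≈±I⇒diagonal (subst (_≈± I) body≡ n≈±I)))
  where body≡ = trans (evalZ-++ (blocksWord W) []) (*Z-identityʳ (evalZ (blocksWord W)))
word≈±I⇒nf-ε (nf true  W T⁰) n≈±I =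
  ⊥-elim (Sz-*Z-nondiagonal (blocks-positive W) (≈±I⇒diagonal (subst (_≈± I) body≡ n≈±I)))
  where body≡ = cong (Sz *Z_) (trans (evalZ-++ (blocksWord W) []) (*Z-identityʳ (evalZ (blocksWord W))))
word≈±I⇒nf-ε (nf false W T¹) n≈±I =
  ⊥-elim (*Z-Sz-nondiagonal (*Z-blockZ-positive R-block (blocks-positive W))
                            (≈±I⇒diagonal (subst (_≈± I) (evalZ-body W R-block) n≈±I)))
word≈±I⇒nf-ε (nf false W T²) n≈±I =
  ⊥-elim (*Z-Sz-nondiagonal (*Z-blockZ-positive L-block (blocks-positive W))
                            (≈±I⇒diagonal (subst (_≈± I) (evalZ-body W L-block) n≈±I)))
word≈±I⇒nf-ε (nf true  W T¹) n≈±I =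
  ⊥-elim (*Z-blockZ-nondiagonal R-block (blocks-positive W)
           (Sz-conjugate-diagonal (evalZ (blocksWord W) *Z Rz)
             (≈±I⇒diagonal (subst (_≈± I) (cong (Sz *Z_) (evalZ-body W R-block)) n≈±I))))
word≈±I⇒nf-ε (nf true  W T²) n≈±I =
  ⊥-elim (*Z-blockZ-nondiagonal L-block (blocks-positive W)
           (Sz-conjugate-diagonal (evalZ (blocksWord W) *Z Lz)
             (≈±I⇒diagonal (subst (_≈± I) (cong (Sz *Z_) (evalZ-body W L-block)) n≈±I))))

evalZ-normalForm : ∀ w → evalZ (word (normalForm w)) ≈± evalZ w
evalZ-normalForm w = ∼⇒evalZ-≈± (word (normalForm w)) w (∼-sym (eval∼normalForm w))

normalForm-injective : ∀ v w → evalZ v ≈± evalZ w → normalForm v ≡ normalForm w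
normalForm-injective v w v≈±w = begin
  normalForm v                                         ≡⟨ actWord-inverse w (normalForm v) ⟨
  actWord w (actWord (inverseWord w) (normalForm v))   ≡⟨ cong (actWord w) (ListP.foldr-++ act nf-ε (inverseWord w) v) ⟨
  actWord w (normalForm (inverseWord w ++ v))          ≡⟨ cong (actWord w) (word≈±I⇒nf-ε (normalForm u) nf-u≈±I) ⟩
  normalForm w                                         ∎
  where
  open ≡-Reasoning
  u = inverseWord w ++ v
  u≈±I : evalZ u ≈± I
  u≈±I = subst₂ _≈±_ (sym (trans (evalZ-++ (inverseWord w) v) (cong (_*Z evalZ v) (evalZ-inverseWord w))))
                      (adjZ-inverseˡ (evalZ w) (detZ-evalZ w))
                      (≈±-congˡ (adjZ (evalZ w)) v≈±w)
  nf-u≈±I : evalZ (word (normalForm u)) ≈± I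
  nf-u≈±I = ≈±-trans (evalZ-normalForm u) u≈±I

evalZ-injective : ∀ v w → evalZ v ≈± evalZ w → eval v ∼ eval w
evalZ-injective v w v≈±w =
  ∼-trans (eval∼normalForm v)
          (subst (λ n → eval (word n) ∼ eval w) (sym (normalForm-injective v w v≈±w)) (∼-sym (eval∼normalForm w)))

-- Every matrix of SL(2, ℤ) is, up to sign, a product of generators

RpowWord : ℤ → List Gen
RpowWord (+ n)    = replicate n R
RpowWord -[1+ n ] = replicate (suc n) R⁻

evalZ-RpowWord : ∀ k → evalZ (RpowWord k) ≡ matZ (+ 1) k (+ 0) (+ 1)
evalZ-RpowWord (+ zero)        = refl
evalZ-RpowWord (+ suc n)       = begin
  Rz *Z evalZ (RpowWord (+ n))            ≡⟨ cong (Rz *Z_) (evalZ-RpowWord (+ n)) ⟩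
  Rz *Z matZ (+ 1) (+ n) (+ 0) (+ 1)      ≡⟨ Rz-*Z (+ 1) (+ n) (+ 0) (+ 1) ⟩
  matZ (+ 1) (+ (n ℕ.+ 1)) (+ 0) (+ 1)    ≡⟨ cong (λ m → matZ (+ 1) (+ m) (+ 0) (+ 1)) (ℕP.+-comm n 1) ⟩
  matZ (+ 1) (+ suc n) (+ 0) (+ 1)        ∎
  where open ≡-Reasoning
evalZ-RpowWord -[1+ zero ]     = *Z-identityʳ (genZ R⁻)
evalZ-RpowWord -[1+ suc n ]    = begin
  genZ R⁻ *Z evalZ (RpowWord -[1+ n ])         ≡⟨ cong (genZ R⁻ *Z_) (evalZ-RpowWord -[1+ n ]) ⟩
  genZ R⁻ *Z matZ (+ 1) -[1+ n ] (+ 0) (+ 1)   ≡⟨ matZ-cong refl (entry -[1+ n ]) refl refl ⟩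
  matZ (+ 1) (-[1+ n ] ℤ.- + 1) (+ 0) (+ 1)    ≡⟨ cong (λ m → matZ (+ 1) -[1+ suc m ] (+ 0) (+ 1)) (ℕP.+-identityʳ n) ⟩
  matZ (+ 1) -[1+ suc n ] (+ 0) (+ 1)          ∎
  where
  open ≡-Reasoning
  entry : ∀ x → + 1 ℤ.* x ℤ.+ -[1+ 0 ] ℤ.* + 1 ≡ x ℤ.- + 1
  entry = ℤSolver.solve-∀

*≡1⇒±1 : ∀ a d → a ℤ.* d ≡ + 1 → (a ≡ + 1 × d ≡ + 1) ⊎ (a ≡ -[1+ 0 ] × d ≡ -[1+ 0 ])
*≡1⇒±1 (+ zero)   d          ()
*≡1⇒±1 +[1+ m ]   (+ zero)   ad≡1 = ⊥-elim (ℕP.0≢1+n (ℤP.+-injective (trans (sym (ℤP.*-zeroʳ +[1+ m ])) ad≡1)))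
*≡1⇒±1 +[1+ m ]   +[1+ n ]   ad≡1 = inj₁ (cong +_ (ℕP.m*n≡1⇒m≡1 (suc m) (suc n) (ℤP.+-injective ad≡1)) ,
                                          cong +_ (ℕP.m*n≡1⇒n≡1 (suc m) (suc n) (ℤP.+-injective ad≡1)))
*≡1⇒±1 +[1+ m ]   -[1+ n ]   ()
*≡1⇒±1 -[1+ m ]   (+ zero)   ad≡1 = ⊥-elim (ℕP.0≢1+n (ℤP.+-injective (trans (sym (ℤP.*-zeroʳ -[1+ m ])) ad≡1)))
*≡1⇒±1 -[1+ m ]   +[1+ n ]   ()
*≡1⇒±1 -[1+ m ]   -[1+ n ]   ad≡1 =
  inj₂ (cong -[1+_] (ℕP.suc-injective (ℕP.m*n≡1⇒m≡1 (suc m) (suc n) (ℤP.+-injective ad≡1))) ,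
        cong -[1+_] (ℕP.suc-injective (ℕP.m*n≡1⇒n≡1 (suc m) (suc n) (ℤP.+-injective ad≡1))))

Preimage : M2Z → Set
Preimage M = Σ[ w ∈ List Gen ] evalZ w ≈± M

upperTriangular-preimage : ∀ a b d → detZ (matZ a b (+ 0) d) ≡ + 1 → Preimage (matZ a b (+ 0) d)
upperTriangular-preimage a b d det≡1 with *≡1⇒±1 a d (trans (sym (det≡ad a b d)) det≡1)
  where
  det≡ad : ∀ a b d → a ℤ.* d ℤ.- b ℤ.* + 0 ≡ a ℤ.* d
  det≡ad = ℤSolver.solve-∀
... | inj₁ (refl , refl) = RpowWord b , inj₁ (evalZ-RpowWord b)
... | inj₂ (refl , refl) = RpowWord (ℤ.- b) , inj₂ (evalZ-RpowWord (ℤ.- b))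

-- With a = k c + r, the matrix [[a, b], [c, d]] is R^k S [[c, d], [-r, k d - b]].
euclidStep : ∀ a b c d .{{_ : ℤ.NonZero c}} → M2Z
euclidStep a b c d = matZ c d (k ℤ.* c ℤ.- a) (k ℤ.* d ℤ.- b)
  where k = a DM./ c

euclidStep-e21 : ∀ a b c d .{{_ : ℤ.NonZero c}} → ℤ.∣ M2Z.e21 (euclidStep a b c d) ∣ ℕ.< ℤ.∣ c ∣
euclidStep-e21 a b c d = subst (ℕ._< ℤ.∣ c ∣) (sym ∣e21∣≡r) (DM.n%d<d a c)
  where
  k = a DM./ c
  r = a DM.% c
  cancel : ∀ x y → x ℤ.- (y ℤ.+ x) ≡ ℤ.- y
  cancel = ℤSolver.solve-∀
  ∣e21∣≡r : ℤ.∣ k ℤ.* c ℤ.- a ∣ ≡ r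
  ∣e21∣≡r = begin
    ℤ.∣ k ℤ.* c ℤ.- a ∣                        ≡⟨ cong (λ x → ℤ.∣ k ℤ.* c ℤ.- x ∣) (DM.a≡a%n+[a/n]*n a c) ⟩
    ℤ.∣ k ℤ.* c ℤ.- (+ r ℤ.+ k ℤ.* c) ∣        ≡⟨ cong ℤ.∣_∣ (cancel (k ℤ.* c) (+ r)) ⟩
    ℤ.∣ ℤ.- + r ∣                               ≡⟨ ℤP.∣-i∣≡∣i∣ (+ r) ⟩
    r                                          ∎
    where open ≡-Reasoning

euclidStep-det : ∀ a b c d .{{_ : ℤ.NonZero c}} → detZ (euclidStep a b c d) ≡ detZ (matZ a b c d)
euclidStep-det a b c d = det≡ a b c d (a DM./ c)
  where
  det≡ : ∀ a b c d k → c ℤ.* (k ℤ.* d ℤ.- b) ℤ.- d ℤ.* (k ℤ.* c ℤ.- a) ≡ a ℤ.* d ℤ.- b ℤ.* c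
  det≡ = ℤSolver.solve-∀

euclidStep-factor : ∀ a b c d .{{_ : ℤ.NonZero c}} →
                    evalZ (RpowWord (a DM./ c) ++ S ∷ []) *Z euclidStep a b c d ≡ matZ a b c d
euclidStep-factor a b c d = begin
  evalZ (RpowWord k ++ S ∷ []) *Z euclidStep a b c d
    ≡⟨ cong (_*Z euclidStep a b c d) (trans (evalZ-++ (RpowWord k) (S ∷ []))
                                              (cong₂ _*Z_ (evalZ-RpowWord k) (*Z-identityʳ Sz))) ⟩
  (matZ (+ 1) k (+ 0) (+ 1) *Z Sz) *Z euclidStep a b c d
    ≡⟨ matZ-cong (e₁ a c k) (e₁ b d k) (e₂ a c k) (e₂ b d k) ⟩
  matZ a b c d  ∎
  where
  open ≡-Reasoning
  k = a DM./ c
  e₁ : ∀ a c k → (+ 1 ℤ.* + 0 ℤ.+ k ℤ.* + 1) ℤ.* c ℤ.+ (+ 1 ℤ.* -[1+ 0 ] ℤ.+ k ℤ.* + 0) ℤ.* (k ℤ.* c ℤ.- a) ≡ a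
  e₁ = ℤSolver.solve-∀
  e₂ : ∀ a c k → (+ 0 ℤ.* + 0 ℤ.+ + 1 ℤ.* + 1) ℤ.* c ℤ.+ (+ 0 ℤ.* -[1+ 0 ] ℤ.+ + 1 ℤ.* + 0) ℤ.* (k ℤ.* c ℤ.- a) ≡ c
  e₂ = ℤSolver.solve-∀

euclidStep-preimage : ∀ a b c d .{{_ : ℤ.NonZero c}} → Preimage (euclidStep a b c d) → Preimage (matZ a b c d)
euclidStep-preimage a b c d (w , w≈±M′) =
  RpowWord (a DM./ c) ++ S ∷ w ,
  subst₂ _≈±_ (sym evalZ≡) (euclidStep-factor a b c d) (≈±-congˡ (evalZ (RpowWord (a DM./ c) ++ S ∷ [])) w≈±M′)
  where
  evalZ≡ : evalZ (RpowWord (a DM./ c) ++ S ∷ w) ≡ evalZ (RpowWord (a DM./ c) ++ S ∷ []) *Z evalZ w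
  evalZ≡ = trans (cong evalZ (sym (ListP.++-assoc (RpowWord (a DM./ c)) (S ∷ []) w)))
                 (evalZ-++ (RpowWord (a DM./ c) ++ S ∷ []) w)

preimage : ∀ n M → ℤ.∣ M2Z.e21 M ∣ ℕ.< n → detZ M ≡ + 1 → Preimage M
preimage (suc n) (matZ a b c d) (ℕ.s≤s ∣c∣≤n) det≡1 with c ℤ.≟ +0
... | yes refl = upperTriangular-preimage a b d det≡1
... | no  c≢0  = euclidStep-preimage a b c d (preimage n (euclidStep a b c d) ∣c′∣<n (trans (euclidStep-det a b c d) det≡1))
  where
  instance _ = ℤ.≢-nonZero c≢0
  ∣c′∣<n = ℕP.<-≤-trans (euclidStep-e21 a b c d) ∣c∣≤n

SL2Z-preimage : ∀ A → Preimage (matrix A)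
SL2Z-preimage A = preimage (suc ℤ.∣ M2Z.e21 (matrix A) ∣) (matrix A) (ℕP.n<1+n _) (det≡1 A)

toSL2Z : List Gen → SL2Z
toSL2Z w = sl (evalZ w) (detZ-evalZ w)

proposition1p3 : ∃ λ f → GroupMorphisms.IsGroupIsomorphism PSLq PSL2Z f
proposition1p3 = toSL2Z , record
  { isGroupMonomorphism = record
    { isGroupHomomorphism = record
      { isMonoidHomomorphism = record
        { isMagmaHomomorphism = record
          { isRelHomomorphism = record { cong = λ {v} {w} v≈w → ∼⇒evalZ-≈± v w (≈PGL⇒∼ v≈w) }
          ; homo = λ v w → inj₁ (evalZ-++ v w)
          }
        ; ε-homo = inj₁ refl
        }
      ; ⁻¹-homo = λ w → inj₁ (evalZ-inverseWord w)
      }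
    ; injective = λ {v} {w} v≈±w → ∼⇒≈PGL (evalZ-injective v w v≈±w)
    }
  ; surjective = λ A → proj₁ (SL2Z-preimage A) ,
      λ {w} w≈v → ≈±-trans (∼⇒evalZ-≈± w (proj₁ (SL2Z-preimage A)) (≈PGL⇒∼ w≈v)) (proj₂ (SL2Z-preimage A))
  }
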